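{- Let $d\ge1$, $r_1,\dots,r_d\in\mathbb{Z}$, and let $(U_n)_{n\ge0}$ be a sequence of integers with $U_n=r_1U_{n-1}+\cdots+r_dU_{n-d}$ for all $n\ge d$, whose characteristic polynomial $C(x)=x^d-r_1x^{d-1}-\cdots-r_d$ is irreducible over $\mathbb{Q}$, with roots $\alpha_0,\dots,\alpha_{d-1}$. Suppose there is a constant $l$ with $U_n=l\sum_{i=0}^{d-1}\alpha_i^n$ for all $n$. Then $(U_n)_{n\ge1}$ almost satisfies the Dold condition.
   Context: A sequence of integers $(A_n)_{n\ge1}$ satisfies the Dold condition if $n\mid\sum_{d\mid n}\mu(d)A_{n/d}$ for every $n\in\mathbb{N}_+$ ($\mu$ the Möbius function). It almost satisfies the Dold condition if there is $c\in\mathbb{N}_+$ such that $(cA_n)_{n\ge1}$ satisfies the Dold condition. -}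

module Defs where

open import Level using (Level; _⊔_)
open import Data.Nat as ℕ using (ℕ; zero; suc; _≤_; _<_)
open import Data.Nat.Divisibility using (_∣?_)
open import Data.Nat.Primality using (prime?)
open import Data.Integer as ℤ using (ℤ; +_; -[1+_])
open import Data.Integer.Divisibility using () renaming (_∣_ to _∣ℤ_)
open import Data.Rational as ℚ using (ℚ)
open import Data.List using (List; upTo; filter; length; foldr; map; applyUpTo)
open import Data.Fin using (Fin; toℕ)
open import Data.Product using (Σ; ∃; _×_; _,_)
open import Data.Empty using (⊥)
open import Relation.Nullary using (¬_; Dec; yes; no; does)
open import Relation.Nullary.Decidable using (⌊_⌋)
open import Data.Bool using (Bool; true; false; if_then_else_)
open import Relation.Binary.PropositionalEquality using (_≡_)
open import Algebra.Bundles using (CommutativeRing)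

Σℤ : ℕ → (ℕ → ℤ) → ℤ
Σℤ zero    f = + 0
Σℤ (suc n) f = Σℤ n f ℤ.+ f n

Σℚ : ℕ → (ℕ → ℚ) → ℚ
Σℚ zero    f = ℚ.0ℚ
Σℚ (suc n) f = Σℚ n f ℚ.+ f n

hasSquareFactor : ℕ → Bool
hasSquareFactor n = foldr (λ k b → ⌊ (k ℕ.* k) ∣? n ⌋ Data.Bool.∨ b) false
                          (map (λ i → suc (suc i)) (upTo n))
  where import Data.Bool

numPrimeDivisors : ℕ → ℕ
numPrimeDivisors n = length (filter (λ p → prime? p Relation.Nullary.Decidable.×-dec (p ∣? n))
                                    (upTo (suc n)))

minusOnePow : ℕ → ℤ
minusOnePow zero    = + 1
minusOnePow (suc k) = ℤ.- minusOnePow k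

μ : ℕ → ℤ
μ n = if hasSquareFactor n then + 0 else minusOnePow (numPrimeDivisors n)

-- Dold condition for a sequence (A_n)_{n ≥ 1} (values at index 0 ignored):
--   n ∣ Σ_{d ∣ n} μ(d) A_{n/d}   for all n ≥ 1.

doldSum : (ℕ → ℤ) → ℕ → ℤ
doldSum A n = Σℤ n (λ k → if ⌊ suc k ∣? n ⌋
                             then μ (suc k) ℤ.* A (n ℕ./ suc k)
                             else + 0)

DoldCondition : (ℕ → ℤ) → Set
DoldCondition A = ∀ n → 1 ≤ n → (+ n) ∣ℤ doldSum A n

AlmostDold : (ℕ → ℤ) → Set
AlmostDold A = Σ ℕ λ c → 1 ≤ c × DoldCondition (λ n → (+ c) ℤ.* A n)

-- Characteristic polynomial C(x) = x^d - r_1 x^(d-1) - ... - r_d,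
-- given by its coefficient sequence (coefficient of x^k).
-- r : ℕ → ℤ, only r 1, ..., r d are used.

charCoeff : ℕ → (ℕ → ℤ) → ℕ → ℤ
charCoeff d r k with k ℕ.≟ d | k ℕ.<? d
... | yes _ | _     = + 1
... | no  _ | yes _ = ℤ.- r (d ℕ.∸ k)
... | no  _ | no  _ = + 0

HasDegree : (ℕ → ℚ) → ℕ → Set
HasDegree f a = ¬ (f a ≡ ℚ.0ℚ) × (∀ k → a < k → f k ≡ ℚ.0ℚ)

polyMul : (ℕ → ℚ) → (ℕ → ℚ) → ℕ → ℚ
polyMul f g k = Σℚ (suc k) (λ i → f i ℚ.* g (k ℕ.∸ i))

IrreducibleOverℚ : ℕ → (ℕ → ℤ) → Set
IrreducibleOverℚ d c =
  1 ≤ d ×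
  ¬ (Σ ℕ λ a → Σ ℕ λ b → Σ (ℕ → ℚ) λ f → Σ (ℕ → ℚ) λ g →
       1 ≤ a × 1 ≤ b × HasDegree f a × HasDegree g b ×
       (∀ k → polyMul f g k ≡ ℚ._/_ (c k) 1))

-- Fields of characteristic zero (standing in for ℂ, which contains the roots).

module OverRing {c ℓ : Level} (K : CommutativeRing c ℓ) where
  open CommutativeRing K

  fromℕ : ℕ → Carrier
  fromℕ zero    = 0#
  fromℕ (suc n) = 1# + fromℕ n

  ι : ℤ → Carrier
  ι (+ n)     = fromℕ n
  ι -[1+ n ]  = - fromℕ (suc n)

  pow : Carrier → ℕ → Carrier
  pow x zero    = 1#
  pow x (suc n) = x * pow x n

  ΣK : ℕ → (ℕ → Carrier) → Carrier
  ΣK zero    f = 0#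
  ΣK (suc n) f = ΣK n f + f n

  IsChar0Field : Set (c ⊔ ℓ)
  IsChar0Field = ¬ (1# ≈ 0#)
               × (∀ x → ¬ (x ≈ 0#) → Σ Carrier λ y → x * y ≈ 1#)
               × (∀ n → ¬ (fromℕ (suc n) ≈ 0#))

  eval : ℕ → (ℕ → ℤ) → Carrier → Carrier
  eval d cf x = ΣK (suc d) (λ k → ι (cf k) * pow x k)

  -- α_0, …, α_{d-1} are the roots of C (listed with multiplicity; C is
  -- separable, so: d pairwise distinct roots of the degree-d polynomial C)
  AreTheRoots : (d : ℕ) → (ℕ → ℤ) → (Fin d → Carrier) → Set ℓ
  AreTheRoots d r α = (∀ i j → α i ≈ α j → i ≡ j)
                    × (∀ i → eval d (charCoeff d r) (α i) ≈ 0#)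

  PowerSumForm : (d : ℕ) → (Fin d → Carrier) → Carrier → (ℕ → ℤ) → Set ℓ
  PowerSumForm d α l U =
    ∀ n → ι (U n) ≈ l * ΣK d (λ i → pow (α' i) n)
    where
      α' : ℕ → Carrier
      α' i with i ℕ.<? d
      ... | yes p = α (Data.Fin.fromℕ< p)
      ... | no  _ = 0#

-- The power sums Tₙ = ∑ αᵢⁿ of the roots of C are integers: they are determined by Newton's
-- identities from the reversed polynomial Q(x) = 1 - r₁ x - ⋯ - r_d x^d.  (These identities hold
-- because ∑ᵢ C(x)/(x - αᵢ) = C′(x): both sides have degree < d and agree at the d distinct roots.)
-- As Uₙ = l Tₙ and T₀ = d, we get d Uₙ = U₀ Tₙ, so c = d works once T satisfies the Dold condition.
-- For this, factor Q formally as ∏_{k ≥ 1} (1 - c_k x^k) with integers c_k.  Newton sequences (the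
-- coefficients of -x Q′/Q) add up over products, and that of 1 - c x^k is k c^(n/k) for k ∣ n and 0
-- otherwise, whose Möbius sums reduce to those of the powers cⁿ.  Finally n ∣ ∑_{d ∣ n} μ(d) c^(n/d)
-- is checked one prime power pᵉ ∥ n at a time, via c^(pᵉ m) ≡ c^(pᵉ⁻¹ m) (mod pᵉ), i.e. Fermat's
-- little theorem lifted along the exponent.

module Submission where

open import Defs
open import Level using (Level)
open import Algebra.Bundles using (CommutativeRing)
import Data.Integer.Properties as ℤ

module FiniteSum {c ℓ : Level} (R : CommutativeRing c ℓ) where

  open CommutativeRing R
  open OverRing R using (fromℕ) renaming (ΣK to ∑)
  open import Algebra.Properties.Ring ring using (-0#≈0#; -‿+-comm)
  open import Algebra.Properties.CommutativeSemigroup +-commutativeSemigroup using (interchange)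
  open import Data.Nat.Base as ℕ using (ℕ; zero; suc; _≤_; _<_; _∸_)
  import Data.Nat.Properties as ℕ
  open import Relation.Binary.PropositionalEquality as ≡ using (_≡_)
  open import Relation.Binary.Reasoning.Setoid setoid
  open import Relation.Nullary using (¬_; yes; no)

  ∑-cong : ∀ n {f g : ℕ → Carrier} → (∀ i → i < n → f i ≈ g i) → ∑ n f ≈ ∑ n g
  ∑-cong zero    f≈g = refl
  ∑-cong (suc n) f≈g = +-cong (∑-cong n (λ i i<n → f≈g i (ℕ.m<n⇒m<1+n i<n))) (f≈g n ℕ.≤-refl)

  ∑-zeros : ∀ n {f : ℕ → Carrier} → (∀ i → i < n → f i ≈ 0#) → ∑ n f ≈ 0#
  ∑-zeros zero    f≈0 = refl
  ∑-zeros (suc n) f≈0 =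
    trans (+-cong (∑-zeros n (λ i i<n → f≈0 i (ℕ.m<n⇒m<1+n i<n))) (f≈0 n ℕ.≤-refl)) (+-identityˡ 0#)

  ∑-distrib-+ : ∀ n (f g : ℕ → Carrier) → ∑ n (λ i → f i + g i) ≈ ∑ n f + ∑ n g
  ∑-distrib-+ zero    f g = sym (+-identityˡ 0#)
  ∑-distrib-+ (suc n) f g = trans (+-congʳ (∑-distrib-+ n f g)) (interchange (∑ n f) (∑ n g) (f n) (g n))

  *-distribˡ-∑ : ∀ n a (f : ℕ → Carrier) → a * ∑ n f ≈ ∑ n (λ i → a * f i)
  *-distribˡ-∑ zero    a f = zeroʳ a
  *-distribˡ-∑ (suc n) a f = trans (distribˡ a _ _) (+-congʳ (*-distribˡ-∑ n a f))

  ∑-neg : ∀ n (f : ℕ → Carrier) → ∑ n (λ i → - f i) ≈ - ∑ n f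
  ∑-neg zero    f = sym -0#≈0#
  ∑-neg (suc n) f = trans (+-congʳ (∑-neg n f)) (-‿+-comm _ _)

  ∑-head : ∀ n (f : ℕ → Carrier) → ∑ (suc n) f ≈ f 0 + ∑ n (λ i → f (suc i))
  ∑-head zero    f = trans (+-identityˡ _) (sym (+-identityʳ _))
  ∑-head (suc n) f = trans (+-congʳ (∑-head n f)) (+-assoc _ _ _)

  ∑-split : ∀ m n (f : ℕ → Carrier) → ∑ (m ℕ.+ n) f ≈ ∑ m f + ∑ n (λ i → f (m ℕ.+ i))
  ∑-split m zero    f = ≡.subst (λ k → ∑ k f ≈ ∑ m f + 0#) (≡.sym (ℕ.+-identityʳ m)) (sym (+-identityʳ _))
  ∑-split m (suc n) f = ≡.subst (λ k → ∑ k f ≈ ∑ m f + ∑ (suc n) (λ i → f (m ℕ.+ i))) (≡.sym (ℕ.+-suc m n))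
    (trans (+-congʳ (∑-split m n f)) (+-assoc _ _ _))

  ∑-truncate : ∀ m n (f : ℕ → Carrier) → m ≤ n → (∀ i → m ≤ i → i < n → f i ≈ 0#) → ∑ n f ≈ ∑ m f
  ∑-truncate m n f m≤n tail≈0 = ≡.subst (λ k → ∑ k f ≈ ∑ m f) (ℕ.m+[n∸m]≡n m≤n) (begin
    ∑ (m ℕ.+ (n ∸ m)) f                   ≈⟨ ∑-split m (n ∸ m) f ⟩
    ∑ m f + ∑ (n ∸ m) (λ i → f (m ℕ.+ i)) ≈⟨ +-congˡ (∑-zeros (n ∸ m) tail≈0′) ⟩
    ∑ m f + 0#                            ≈⟨ +-identityʳ _ ⟩
    ∑ m f                                 ∎)
    where
    tail≈0′ : ∀ i → i < n ∸ m → f (m ℕ.+ i) ≈ 0#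
    tail≈0′ i i<n∸m = tail≈0 (m ℕ.+ i) (ℕ.m≤m+n m i)
      (≡.subst (m ℕ.+ i <_) (ℕ.m+[n∸m]≡n m≤n) (ℕ.+-monoʳ-< m i<n∸m))

  ∑-single : ∀ n k (f : ℕ → Carrier) → k < n → (∀ i → i < n → ¬ i ≡ k → f i ≈ 0#) → ∑ n f ≈ f k
  ∑-single (suc n) k f k<1+n others≈0 with k ℕ.≟ n
  ... | yes ≡.refl = trans (+-congʳ (∑-zeros n (λ i i<n → others≈0 i (ℕ.m<n⇒m<1+n i<n) (ℕ.<⇒≢ i<n))))
                           (+-identityˡ _)
  ... | no k≢n = trans (+-cong (∑-single n k f (ℕ.≤∧≢⇒< (ℕ.≤-pred k<1+n) k≢n)
                                  (λ i i<n → others≈0 i (ℕ.m<n⇒m<1+n i<n)))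
                               (others≈0 n ℕ.≤-refl (λ n≡k → k≢n (≡.sym n≡k))))
                       (+-identityʳ _)

  ∑-comm : ∀ m n (f : ℕ → ℕ → Carrier) → ∑ m (λ i → ∑ n (f i)) ≈ ∑ n (λ j → ∑ m (λ i → f i j))
  ∑-comm zero    n f = sym (∑-zeros n (λ _ _ → refl))
  ∑-comm (suc m) n f = trans (+-congʳ (∑-comm m n f)) (sym (∑-distrib-+ n (λ j → ∑ m (λ i → f i j)) (f m)))

  ∑-reverse : ∀ n (f : ℕ → Carrier) → ∑ (suc n) f ≈ ∑ (suc n) (λ j → f (n ∸ j))
  ∑-reverse zero    f = refl
  ∑-reverse (suc n) f = begin
    ∑ (suc n) f + f (suc n)                       ≈⟨ +-congʳ (∑-reverse n f) ⟩
    ∑ (suc n) (λ j → f (n ∸ j)) + f (suc n)       ≈⟨ +-comm _ _ ⟩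
    f (suc n) + ∑ (suc n) (λ j → f (n ∸ j))       ≈⟨ sym (∑-head (suc n) (λ j → f (suc n ∸ j))) ⟩
    ∑ (suc (suc n)) (λ j → f (suc n ∸ j))         ∎

  ∑-const-1 : ∀ n → ∑ n (λ _ → 1#) ≈ fromℕ n
  ∑-const-1 zero    = refl
  ∑-const-1 (suc n) = trans (+-congʳ (∑-const-1 n)) (+-comm _ _)

  ∑-cong-≡ : ∀ n {f g : ℕ → Carrier} → (∀ i → i < n → f i ≡ g i) → ∑ n f ≡ ∑ n g
  ∑-cong-≡ zero    f≡g = ≡.refl
  ∑-cong-≡ (suc n) f≡g = ≡.cong₂ _+_ (∑-cong-≡ n (λ i i<n → f≡g i (ℕ.m<n⇒m<1+n i<n))) (f≡g n ℕ.≤-refl)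

module NewtonSequence {c ℓ : Level} (R : CommutativeRing c ℓ) where

  open CommutativeRing R
  open OverRing R using (fromℕ) renaming (ΣK to ∑)
  open FiniteSum R
  open import Data.Nat.Base as ℕ using (ℕ; zero; suc; _≤_; _<_; _∸_; z≤n; s≤s)
  open import Algebra.Properties.Ring ring using (-0#≈0#; -‿distribˡ-*)
  open import Algebra.Properties.Group +-group using (inverseˡ-unique)
  import Data.Nat.Properties as ℕ
  open import Data.Nat.Induction using (<-wellFounded; <-rec)
  open import Induction.WellFounded using (WfRec; module FixPoint)
  open import Relation.Binary.PropositionalEquality as ≡ using (_≡_)
  open import Relation.Binary.Reasoning.Setoid setoid

  newtonSum : (F X : ℕ → Carrier) → ℕ → Carrier
  newtonSum F X n = ∑ n (λ i → F i * X (n ∸ i))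

  newtonDefect : (F X : ℕ → Carrier) → ℕ → Carrier
  newtonDefect F X n = newtonSum F X n + fromℕ n * F n

  -- X₁, X₂, … are the coefficients of -x F′(x) / F(x); for F = ∏ (1 - α x) these are the
  -- power sums of the α, and the equations are Newton's identities.  X₀ is unconstrained.
  PowerSums : (F X : ℕ → Carrier) → Set ℓ
  PowerSums F X = ∀ n → newtonDefect F X n ≈ 0#

  newtonTail : (F X : ℕ → Carrier) → ℕ → Carrier
  newtonTail F X n = ∑ n (λ i → F (suc i) * X (n ∸ i)) + fromℕ (suc n) * F (suc n)

  newtonDefect-suc : ∀ F X n → newtonDefect F X (suc n) ≈ F 0 * X (suc n) + newtonTail F X n
  newtonDefect-suc F X n = trans (+-congʳ (∑-head n (λ i → F i * X (suc n ∸ i)))) (+-assoc _ _ _)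

  newtonTail-cong : ∀ F {X Y} n → (∀ m → m ≤ n → X m ≈ Y m) → newtonTail F X n ≈ newtonTail F Y n
  newtonTail-cong F n X≈Y = +-congʳ (∑-cong n (λ i _ → *-congˡ (X≈Y (n ∸ i) (ℕ.m∸n≤m n i))))

  powerSums-suc : ∀ {F X} → F 0 ≈ 1# → PowerSums F X → ∀ n → X (suc n) ≈ - newtonTail F X n
  powerSums-suc {F} {X} F₀≈1 ps n = inverseˡ-unique _ _ (begin
    X (suc n) + newtonTail F X n          ≈⟨ +-congʳ (sym (trans (*-congʳ F₀≈1) (*-identityˡ _))) ⟩
    F 0 * X (suc n) + newtonTail F X n    ≈⟨ sym (newtonDefect-suc F X n) ⟩
    newtonDefect F X (suc n)              ≈⟨ ps (suc n) ⟩
    0#                                    ∎)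

  powerSums-unique : ∀ {F X Y} → F 0 ≈ 1# → PowerSums F X → PowerSums F Y → X 0 ≈ Y 0 → ∀ n → X n ≈ Y n
  powerSums-unique {F} {X} {Y} F₀≈1 psX psY X₀≈Y₀ = <-rec _ step
    where
    step : ∀ n → WfRec _<_ (λ m → X m ≈ Y m) n → X n ≈ Y n
    step zero    _  = X₀≈Y₀
    step (suc n) IH = begin
      X (suc n)              ≈⟨ powerSums-suc {X = X} F₀≈1 psX n ⟩
      - newtonTail F X n     ≈⟨ -‿cong (newtonTail-cong F n (λ m m≤n → IH (s≤s m≤n))) ⟩
      - newtonTail F Y n     ≈⟨ sym (powerSums-suc {X = Y} F₀≈1 psY n) ⟩
      Y (suc n)              ∎

  newtonSum-congˡ : ∀ {F G} X n → (∀ i → F i ≈ G i) → newtonSum F X n ≈ newtonSum G X n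
  newtonSum-congˡ X n F≈G = ∑-cong n (λ i _ → *-congʳ (F≈G i))

  newtonSum-congʳ : ∀ F {X Y} n → (∀ m → X m ≈ Y m) → newtonSum F X n ≈ newtonSum F Y n
  newtonSum-congʳ F n X≈Y = ∑-cong n (λ i _ → *-congˡ (X≈Y (n ∸ i)))

  newtonSum-distribʳ-+ : ∀ F X Y n → newtonSum F (λ m → X m + Y m) n ≈ newtonSum F X n + newtonSum F Y n
  newtonSum-distribʳ-+ F X Y n =
    trans (∑-cong n (λ i _ → distribˡ (F i) _ _)) (∑-distrib-+ n _ _)

  newtonSum-linearˡ : ∀ F G c X n →
                      newtonSum (λ i → F i - c * G i) X n ≈ newtonSum F X n - c * newtonSum G X n
  newtonSum-linearˡ F G c X n = begin
    ∑ n (λ i → (F i - c * G i) * X (n ∸ i))                   ≈⟨ ∑-cong n (λ i _ → termwise (F i) (G i) (X (n ∸ i))) ⟩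
    ∑ n (λ i → F i * X (n ∸ i) - c * (G i * X (n ∸ i)))       ≈⟨ ∑-distrib-+ n _ _ ⟩
    newtonSum F X n + ∑ n (λ i → - (c * (G i * X (n ∸ i))))   ≈⟨ +-congˡ (∑-neg n _) ⟩
    newtonSum F X n - ∑ n (λ i → c * (G i * X (n ∸ i)))       ≈⟨ +-congˡ (-‿cong (sym (*-distribˡ-∑ n c _))) ⟩
    newtonSum F X n - c * newtonSum G X n                     ∎
    where
    termwise : ∀ f g x → (f - c * g) * x ≈ f * x - c * (g * x)
    termwise f g x = trans (distribʳ x f (- (c * g)))
                           (+-congˡ (trans (sym (-‿distribˡ-* (c * g) x)) (-‿cong (*-assoc c g x))))

  powerSums-congʳ : ∀ F {X Y} → (∀ m → X m ≈ Y m) → PowerSums F X → PowerSums F Y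
  powerSums-congʳ F X≈Y psX n = trans (+-congʳ (newtonSum-congʳ F n (λ m → sym (X≈Y m)))) (psX n)

  powerSums-vanish : ∀ {F X} N → F 0 ≈ 1# → PowerSums F X → (∀ i → 1 ≤ i → i ≤ N → F i ≈ 0#) →
                     ∀ m → 1 ≤ m → m ≤ N → X m ≈ 0#
  powerSums-vanish {F} {X} N F₀≈1 ps F≈0 (suc m) _ 1+m≤N = begin
    X (suc m)                                                         ≈⟨ powerSums-suc {X = X} F₀≈1 ps m ⟩
    - (∑ m (λ i → F (suc i) * X (m ∸ i)) + fromℕ (suc m) * F (suc m)) ≈⟨ -‿cong (+-cong sum≈0 last≈0) ⟩
    - (0# + 0#)                                                       ≈⟨ -‿cong (+-identityˡ 0#) ⟩
    - 0#                                                              ≈⟨ -0#≈0# ⟩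
    0#                                                                ∎
    where
    sum≈0 : ∑ m (λ i → F (suc i) * X (m ∸ i)) ≈ 0#
    sum≈0 = ∑-zeros m (λ i i<m → trans (*-congʳ (F≈0 (suc i) (s≤s z≤n) (ℕ.≤-trans i<m (ℕ.<⇒≤ 1+m≤N))))
                                       (zeroˡ _))
    last≈0 : fromℕ (suc m) * F (suc m) ≈ 0#
    last≈0 = trans (*-congˡ (F≈0 (suc m) (s≤s z≤n) 1+m≤N)) (zeroʳ _)

  module _ (F : ℕ → Carrier) (X₀ : Carrier) where

    private
      newtonStep : ∀ n → WfRec _<_ (λ _ → Carrier) n → Carrier
      newtonStep zero    _  = X₀
      newtonStep (suc n) IH = - (∑ n (λ i → F (suc i) * IH (s≤s (ℕ.m∸n≤m n i))) + fromℕ (suc n) * F (suc n))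

      newtonStep-ext : ∀ n {IH IH′ : WfRec _<_ (λ _ → Carrier) n} →
                       (∀ {m} (m<n : m < n) → IH m<n ≡ IH′ m<n) → newtonStep n IH ≡ newtonStep n IH′
      newtonStep-ext zero    _      = ≡.refl
      newtonStep-ext (suc n) IH≡IH′ =
        ≡.cong (λ t → - (t + fromℕ (suc n) * F (suc n))) (∑-cong-≡ n (λ i _ → ≡.cong (F (suc i) *_) (IH≡IH′ _)))

    newtonSeq : ℕ → Carrier
    newtonSeq = <-rec _ newtonStep

    newtonSeq-zero : newtonSeq 0 ≡ X₀
    newtonSeq-zero = FixPoint.unfold-wfRec <-wellFounded _ newtonStep newtonStep-ext {0}

    newtonSeq-powerSums : F 0 ≈ 1# → PowerSums F newtonSeq
    newtonSeq-powerSums F₀≈1 zero    = trans (+-identityˡ _) (zeroˡ (F 0))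
    newtonSeq-powerSums F₀≈1 (suc n) = begin
      newtonDefect F newtonSeq (suc n)           ≈⟨ newtonDefect-suc F newtonSeq n ⟩
      F 0 * newtonSeq (suc n) + t                ≡⟨ ≡.cong (λ x → F 0 * x + t) unfold ⟩
      F 0 * - t + t                              ≈⟨ +-congʳ (trans (*-congʳ F₀≈1) (*-identityˡ _)) ⟩
      - t + t                                    ≈⟨ -‿inverseˡ t ⟩
      0#                                         ∎
      where
      t = newtonTail F newtonSeq n
      unfold : newtonSeq (suc n) ≡ - t
      unfold = FixPoint.unfold-wfRec <-wellFounded _ newtonStep newtonStep-ext {suc n}

module IntegerRing where

  open import Data.Nat.Base as ℕ using (ℕ; zero; suc; _<_)
  import Data.Nat.Properties as ℕ
  open import Data.Integer.Base as ℤ using (ℤ; +_)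
  open import Data.Integer.Divisibility.Signed using (_∣_; divides; ∣m∣n⇒∣m+n)
  open import Relation.Binary.PropositionalEquality using (_≡_; refl; cong)

  open OverRing ℤ.+-*-commutativeRing public using (fromℕ) renaming (ΣK to ∑)
  open FiniteSum ℤ.+-*-commutativeRing public
  open NewtonSequence ℤ.+-*-commutativeRing public

  fromℕ≡+ : ∀ n → fromℕ n ≡ + n
  fromℕ≡+ zero    = refl
  fromℕ≡+ (suc n) = cong (ℤ._+_ (+ 1)) (fromℕ≡+ n)

  ∑-∣ : ∀ {a} n (f : ℕ → ℤ) → (∀ i → i < n → a ∣ f i) → a ∣ ∑ n f
  ∑-∣ zero    f a∣f = divides (+ 0) refl
  ∑-∣ (suc n) f a∣f = ∣m∣n⇒∣m+n (∑-∣ n f (λ i i<n → a∣f i (ℕ.m<n⇒m<1+n i<n))) (a∣f n ℕ.≤-refl)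

module IntegerEmbedding {c ℓ : Level} (R : CommutativeRing c ℓ) where

  open CommutativeRing R
  open OverRing R renaming (ΣK to ∑)
  open import Algebra.Properties.Ring ring using (-‿distribˡ-*; -‿distribʳ-*; -‿involutive; -‿+-comm; -0#≈0#)
  open import Algebra.Definitions.RawMonoid +-rawMonoid using (_×_)
  open import Algebra.Properties.Monoid.Mult +-monoid using (×-homo-+)
  open import Algebra.Properties.Semiring.Mult semiring using (×1-homo-*)
  import Algebra.Solver.Ring.AlmostCommutativeRing as ACR
  import Algebra.Solver.Ring
  open import Data.Nat.Base as ℕ using (ℕ; zero; suc)
  open import Data.Integer.Base as ℤ using (ℤ; +_; -[1+_]; _⊖_)
  open import Data.Maybe.Base using (Maybe; just; nothing)
  open import Relation.Binary.PropositionalEquality as ≡ using (_≡_)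
  open import Relation.Binary.Reasoning.Setoid setoid
  open import Relation.Nullary using (¬_; yes; no)
  open import Data.Empty using (⊥-elim)

  fromℕ≡×1# : ∀ n → fromℕ n ≡ n × 1#
  fromℕ≡×1# zero    = ≡.refl
  fromℕ≡×1# (suc n) = ≡.cong (_+_ 1#) (fromℕ≡×1# n)

  fromℕ-+ : ∀ m n → fromℕ (m ℕ.+ n) ≈ fromℕ m + fromℕ n
  fromℕ-+ m n rewrite fromℕ≡×1# (m ℕ.+ n) | fromℕ≡×1# m | fromℕ≡×1# n = ×-homo-+ 1# m n

  fromℕ-* : ∀ m n → fromℕ (m ℕ.* n) ≈ fromℕ m * fromℕ n
  fromℕ-* m n rewrite fromℕ≡×1# (m ℕ.* n) | fromℕ≡×1# m | fromℕ≡×1# n = ×1-homo-* m n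

  ι-⊖ : ∀ m n → ι (m ⊖ n) ≈ fromℕ m - fromℕ n
  ι-⊖ m       zero    = begin
    ι (m ⊖ 0)        ≡⟨ ≡.cong ι (ℤ.⊖-≥ {m} ℕ.z≤n) ⟩
    fromℕ m          ≈⟨ sym (+-identityʳ _) ⟩
    fromℕ m + 0#     ≈⟨ +-congˡ (sym -0#≈0#) ⟩
    fromℕ m - 0#     ∎
  ι-⊖ zero    (suc n) = sym (+-identityˡ _)
  ι-⊖ (suc m) (suc n) = begin
    ι (suc m ⊖ suc n)                   ≡⟨ ≡.cong ι (ℤ.[1+m]⊖[1+n]≡m⊖n m n) ⟩
    ι (m ⊖ n)                           ≈⟨ ι-⊖ m n ⟩
    fromℕ m - fromℕ n                   ≈⟨ sym (+-identityˡ _) ⟩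
    0# + (fromℕ m - fromℕ n)            ≈⟨ +-congʳ (sym (-‿inverseʳ 1#)) ⟩
    (1# - 1#) + (fromℕ m - fromℕ n)     ≈⟨ +-assoc _ _ _ ⟩
    1# + (- 1# + (fromℕ m - fromℕ n))   ≈⟨ +-congˡ (sym (+-assoc _ _ _)) ⟩
    1# + ((- 1# + fromℕ m) - fromℕ n)   ≈⟨ +-congˡ (+-congʳ (+-comm _ _)) ⟩
    1# + ((fromℕ m - 1#) - fromℕ n)     ≈⟨ +-congˡ (+-assoc _ _ _) ⟩
    1# + (fromℕ m + (- 1# - fromℕ n))   ≈⟨ +-congˡ (+-congˡ (-‿+-comm 1# (fromℕ n))) ⟩
    1# + (fromℕ m - (1# + fromℕ n))     ≈⟨ sym (+-assoc _ _ _) ⟩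
    fromℕ (suc m) - fromℕ (suc n)       ∎

  ι-neg : ∀ x → ι (ℤ.- x) ≈ - ι x
  ι-neg (+ zero)  = sym -0#≈0#
  ι-neg (+ suc n) = refl
  ι-neg -[1+ n ]  = sym (-‿involutive _)

  ι-+ : ∀ x y → ι (x ℤ.+ y) ≈ ι x + ι y
  ι-+ (+ m)    (+ n)    = fromℕ-+ m n
  ι-+ (+ m)    -[1+ n ] = ι-⊖ m (suc n)
  ι-+ -[1+ m ] (+ n)    = trans (ι-⊖ n (suc m)) (+-comm _ _)
  ι-+ -[1+ m ] -[1+ n ] = begin
    - fromℕ (suc (suc (m ℕ.+ n)))                ≈⟨ -‿cong (+-congˡ (fromℕ-+ (suc m) n)) ⟩
    - (1# + (fromℕ (suc m) + fromℕ n))           ≈⟨ -‿cong (sym (+-assoc _ _ _)) ⟩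
    - ((1# + fromℕ (suc m)) + fromℕ n)           ≈⟨ -‿cong (+-congʳ (+-comm _ _)) ⟩
    - ((fromℕ (suc m) + 1#) + fromℕ n)           ≈⟨ -‿cong (+-assoc _ _ _) ⟩
    - (fromℕ (suc m) + fromℕ (suc n))            ≈⟨ sym (-‿+-comm _ _) ⟩
    - fromℕ (suc m) - fromℕ (suc n)              ∎

  ι-pos-* : ∀ m y → ι (+ m ℤ.* y) ≈ fromℕ m * ι y
  ι-pos-* m (+ n)    = ≡.subst (λ z → ι z ≈ fromℕ m * fromℕ n) (ℤ.pos-* m n) (fromℕ-* m n)
  ι-pos-* m -[1+ n ] = begin
    ι (+ m ℤ.* ℤ.- + suc n)      ≡⟨ ≡.cong ι (≡.sym (ℤ.neg-distribʳ-* (+ m) (+ suc n))) ⟩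
    ι (ℤ.- (+ m ℤ.* + suc n))    ≈⟨ ι-neg (+ m ℤ.* + suc n) ⟩
    - ι (+ m ℤ.* + suc n)        ≈⟨ -‿cong (ι-pos-* m (+ suc n)) ⟩
    - (fromℕ m * fromℕ (suc n))  ≈⟨ -‿distribʳ-* _ _ ⟩
    fromℕ m * - fromℕ (suc n)    ∎

  ι-* : ∀ x y → ι (x ℤ.* y) ≈ ι x * ι y
  ι-* (+ m)    y = ι-pos-* m y
  ι-* -[1+ m ] y = begin
    ι (ℤ.- + suc m ℤ.* y)        ≡⟨ ≡.cong ι (≡.sym (ℤ.neg-distribˡ-* (+ suc m) y)) ⟩
    ι (ℤ.- (+ suc m ℤ.* y))      ≈⟨ ι-neg (+ suc m ℤ.* y) ⟩
    - ι (+ suc m ℤ.* y)          ≈⟨ -‿cong (ι-pos-* (suc m) y) ⟩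
    - (fromℕ (suc m) * ι y)      ≈⟨ -‿distribˡ-* _ _ ⟩
    - fromℕ (suc m) * ι y        ∎

  ι-1 : ι (+ 1) ≈ 1#
  ι-1 = +-identityʳ 1#

  ι-∑ : ∀ n (f : ℕ → ℤ) → ι (IntegerRing.∑ n f) ≈ ∑ n (λ i → ι (f i))
  ι-∑ zero    f = refl
  ι-∑ (suc n) f = trans (ι-+ (IntegerRing.∑ n f) (f n)) (+-congʳ (ι-∑ n f))

  ι-injective : (∀ n → ¬ fromℕ (suc n) ≈ 0#) → ∀ x y → ι x ≈ ι y → x ≡ y
  ι-injective char0 x y ιx≈ιy = ℤ.i-j≡0⇒i≡j x y (ι≈0 (x ℤ.- y) (begin
    ι (x ℤ.- y)     ≈⟨ ι-+ x (ℤ.- y) ⟩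
    ι x + ι (ℤ.- y) ≈⟨ +-cong ιx≈ιy (ι-neg y) ⟩
    ι y - ι y       ≈⟨ -‿inverseʳ (ι y) ⟩
    0#              ∎))
    where
    ι≈0 : ∀ z → ι z ≈ 0# → z ≡ + 0
    ι≈0 (+ zero)  _   = ≡.refl
    ι≈0 (+ suc n) ι≈0 = ⊥-elim (char0 n ι≈0)
    ι≈0 -[1+ n ]  ι≈0 = ⊥-elim (char0 n (trans (sym (-‿involutive _)) (trans (-‿cong ι≈0) -0#≈0#)))

  ι-homomorphism : ACR.AlmostCommutativeRing.rawRing (ACR.fromCommutativeRing ℤ.+-*-commutativeRing)
                     ACR.-Raw-AlmostCommutative⟶ ACR.fromCommutativeRing R
  ι-homomorphism = record
    { ⟦_⟧ = ι ; +-homo = ι-+ ; *-homo = ι-* ; -‿homo = ι-neg ; 0-homo = refl ; 1-homo = ι-1 }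

  ι-≟ : ∀ x y → Maybe (ι x ≈ ι y)
  ι-≟ x y with x ℤ.≟ y
  ... | yes ≡.refl = just refl
  ... | no _       = nothing

  module ℤ-Solver = Algebra.Solver.Ring _ (ACR.fromCommutativeRing R) ι-homomorphism ι-≟

module RadicalDecomposition where

  open import Data.Nat.Base as ℕ using (ℕ; zero; suc; _≤_; _<_; _∸_; z≤n; s≤s)
  open import Data.Nat.Properties using (_≤?_)
  import Data.Nat.Properties as ℕ
  open import Data.Nat.DivMod using (_/_; m/n≡1+[m∸n]/n)
  open import Data.Nat.Divisibility using (_∣?_; ∣-refl; ∣m+n∣m⇒∣n; ∣m∣n⇒∣m+n; >⇒∤; _∣0)
  open import Data.Integer.Base using (ℤ; +_; _+_; _*_; -_; _-_; _^_)
  import Data.Integer.Properties as ℤ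
  open import Data.Integer.Tactic.RingSolver using (solve-∀)
  open import Algebra.Properties.CommutativeSemigroup ℤ.*-commutativeSemigroup using (x∙yz≈y∙xz)
  open import Data.Bool.Base using (if_then_else_)
  open import Data.Sum.Base using (_⊎_; inj₁; inj₂)
  open import Data.Nat.Induction using (<-wellFounded; <-rec)
  open import Induction.WellFounded using (WfRec; module FixPoint)
  open import Relation.Nullary using (¬_; yes; no)
  open import Relation.Nullary.Decidable using (⌊_⌋)
  open import Relation.Binary.PropositionalEquality as ≡ hiding (J)
  open import Data.Empty using (⊥-elim)
  open IntegerRing
  open ≡-Reasoning

  shift : ℕ → (ℕ → ℤ) → ℕ → ℤ
  shift J X n with J ≤? n
  ... | yes _ = X (n ∸ J)
  ... | no  _ = + 0

  shift-≥ : ∀ {J n} X → J ≤ n → shift J X n ≡ X (n ∸ J)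
  shift-≥ {J} {n} X J≤n with J ≤? n
  ... | yes _   = refl
  ... | no  J≰n = ⊥-elim (J≰n J≤n)

  shift-< : ∀ {J n} X → n < J → shift J X n ≡ + 0
  shift-< {J} {n} X n<J with J ≤? n
  ... | yes J≤n = ⊥-elim (ℕ.<⇒≱ n<J J≤n)
  ... | no  _   = refl

  shift-+ : ∀ J X m → shift J X (J ℕ.+ m) ≡ X m
  shift-+ J X m = trans (shift-≥ X (ℕ.m≤m+n J m)) (cong X (ℕ.m+n∸m≡n J m))

  newtonSum-shiftˡ-+ : ∀ J F X m → newtonSum (shift J F) X (J ℕ.+ m) ≡ newtonSum F X m
  newtonSum-shiftˡ-+ J F X m = begin
    newtonSum (shift J F) X (J ℕ.+ m)
      ≡⟨ ∑-split J m _ ⟩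
    ∑ J (λ i → shift J F i * X (J ℕ.+ m ∸ i)) + ∑ m (λ i → shift J F (J ℕ.+ i) * X (J ℕ.+ m ∸ (J ℕ.+ i)))
      ≡⟨ cong₂ _+_ (∑-zeros J (λ i i<J → trans (cong (_* X (J ℕ.+ m ∸ i)) (shift-< F i<J)) (ℤ.*-zeroˡ (X (J ℕ.+ m ∸ i)))))
                   (∑-cong m (λ i _ → cong₂ _*_ (trans (shift-≥ F (ℕ.m≤m+n J i)) (cong F (ℕ.m+n∸m≡n J i)))
                                                (cong X (ℕ.[m+n]∸[m+o]≡n∸o J m i)))) ⟩
    + 0 + newtonSum F X m
      ≡⟨ ℤ.+-identityˡ _ ⟩
    newtonSum F X m ∎

  newtonSum-shiftˡ : ∀ J F X n → newtonSum (shift J F) X n ≡ shift J (newtonSum F X) n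
  newtonSum-shiftˡ J F X n with J ≤? n
  ... | yes J≤n = trans (cong (newtonSum (shift J F) X) (sym (ℕ.m+[n∸m]≡n J≤n)))
                        (newtonSum-shiftˡ-+ J F X (n ∸ J))
  ... | no  J≰n = ∑-zeros n (λ i i<n → trans (cong (_* X (n ∸ i)) (shift-< F (ℕ.<-trans i<n (ℕ.≰⇒> J≰n))))
                                             (ℤ.*-zeroˡ (X (n ∸ i))))

  -- The power sums ∑ ζᵐ over the (1+j)-th roots ζ of c, i.e. the Newton sequence of 1 - c x^(1+j).
  radicalSums : ℕ → ℤ → ℕ → ℤ
  radicalSums j c m = if ⌊ suc j ∣? m ⌋ then + suc j * c ^ (m / suc j) else + 0

  radicalSums-+ : ∀ j c t → radicalSums j c (suc j ℕ.+ t) ≡ c * radicalSums j c t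
  radicalSums-+ j c t with suc j ∣? (suc j ℕ.+ t) | suc j ∣? t
  ... | yes _ | yes _ = begin
    + suc j * c ^ ((suc j ℕ.+ t) / suc j)  ≡⟨ cong (λ e → + suc j * c ^ e) quotient-+1 ⟩
    + suc j * (c * c ^ (t / suc j))        ≡⟨ ℤ.*-comm (+ suc j) _ ⟩
    c * c ^ (t / suc j) * + suc j          ≡⟨ ℤ.*-assoc c _ _ ⟩
    c * (c ^ (t / suc j) * + suc j)        ≡⟨ cong (c *_) (ℤ.*-comm _ (+ suc j)) ⟩
    c * (+ suc j * c ^ (t / suc j))        ∎
    where
    quotient-+1 : (suc j ℕ.+ t) / suc j ≡ suc (t / suc j)
    quotient-+1 = trans (m/n≡1+[m∸n]/n (ℕ.m≤m+n (suc j) t)) (cong (λ u → suc (u / suc j)) (ℕ.m+n∸m≡n (suc j) t))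
  ... | yes J∣J+t | no  J∤t = ⊥-elim (J∤t (∣m+n∣m⇒∣n J∣J+t ∣-refl))
  ... | no  J∤J+t | yes J∣t = ⊥-elim (J∤J+t (∣m∣n⇒∣m+n ∣-refl J∣t))
  ... | no  _     | no  _   = sym (ℤ.*-zeroʳ c)

  radicalSums-< : ∀ j c s → 0 < s → s < suc j → radicalSums j c s ≡ + 0
  radicalSums-< j c (suc s) _ s<J with suc j ∣? suc s
  ... | yes J∣s = ⊥-elim (>⇒∤ s<J J∣s)
  ... | no  _   = refl

  radicalSums-0 : ∀ j c → radicalSums j c 0 ≡ + suc j
  radicalSums-0 j c with suc j ∣? 0
  ... | yes _   = ℤ.*-identityʳ (+ suc j)
  ... | no  J∤0 = ⊥-elim (J∤0 (suc j ∣0))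

  radicalSums-1+j : ∀ j c → radicalSums j c (suc j) ≡ + suc j * c
  radicalSums-1+j j c = begin
    radicalSums j c (suc j)            ≡⟨ cong (radicalSums j c) (sym (ℕ.+-identityʳ (suc j))) ⟩
    radicalSums j c (suc j ℕ.+ 0)      ≡⟨ radicalSums-+ j c 0 ⟩
    c * radicalSums j c 0              ≡⟨ cong (c *_) (radicalSums-0 j c) ⟩
    c * + suc j                        ≡⟨ ℤ.*-comm c _ ⟩
    + suc j * c                        ∎

  newtonSum-radicalSums-+ : ∀ F j c m → newtonSum F (radicalSums j c) (suc j ℕ.+ m)
                                        ≡ c * newtonSum F (radicalSums j c) m + + suc j * c * F m
  newtonSum-radicalSums-+ F j c m = begin
    newtonSum F E (J ℕ.+ m)                                    ≡⟨ cong (newtonSum F E) (ℕ.+-comm J m) ⟩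
    ∑ (m ℕ.+ J) (λ i → F i * E (m ℕ.+ J ∸ i))                  ≡⟨ ∑-split m J _ ⟩
    ∑ m (λ i → F i * E (m ℕ.+ J ∸ i))
      + ∑ J (λ i → F (m ℕ.+ i) * E (m ℕ.+ J ∸ (m ℕ.+ i)))      ≡⟨ cong₂ _+_ early late ⟩
    c * newtonSum F E m + + J * c * F m                        ∎
    where
    J = suc j
    E = radicalSums j c
    early : ∑ m (λ i → F i * E (m ℕ.+ J ∸ i)) ≡ c * newtonSum F E m
    early = begin
      ∑ m (λ i → F i * E (m ℕ.+ J ∸ i))   ≡⟨ ∑-cong m (λ i i<m → cong (λ k → F i * E k) (index i i<m)) ⟩
      ∑ m (λ i → F i * E (J ℕ.+ (m ∸ i))) ≡⟨ ∑-cong m (λ i _ → cong (F i *_) (radicalSums-+ j c (m ∸ i))) ⟩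
      ∑ m (λ i → F i * (c * E (m ∸ i)))   ≡⟨ ∑-cong m (λ i _ → x∙yz≈y∙xz (F i) c (E (m ∸ i))) ⟩
      ∑ m (λ i → c * (F i * E (m ∸ i)))   ≡⟨ sym (*-distribˡ-∑ m c _) ⟩
      c * newtonSum F E m                 ∎
      where
      index : ∀ i → i < m → m ℕ.+ J ∸ i ≡ J ℕ.+ (m ∸ i)
      index i i<m = trans (cong (_∸ i) (ℕ.+-comm m J)) (ℕ.+-∸-assoc J (ℕ.<⇒≤ i<m))
    late : ∑ J (λ i → F (m ℕ.+ i) * E (m ℕ.+ J ∸ (m ℕ.+ i))) ≡ + J * c * F m
    late = begin
      ∑ J (λ i → F (m ℕ.+ i) * E (m ℕ.+ J ∸ (m ℕ.+ i)))  ≡⟨ ∑-single J 0 _ (s≤s z≤n) vanishes ⟩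
      F (m ℕ.+ 0) * E (m ℕ.+ J ∸ (m ℕ.+ 0))             ≡⟨ cong₂ (λ k l → F k * E l) (ℕ.+-identityʳ m)
                                                                 (ℕ.[m+n]∸[m+o]≡n∸o m J 0) ⟩
      F m * E J                                         ≡⟨ cong (F m *_) (radicalSums-1+j j c) ⟩
      F m * (+ J * c)                                   ≡⟨ ℤ.*-comm (F m) _ ⟩
      + J * c * F m                                     ∎
      where
      vanishes : ∀ i → i < J → ¬ i ≡ 0 → F (m ℕ.+ i) * E (m ℕ.+ J ∸ (m ℕ.+ i)) ≡ + 0
      vanishes i i<J i≢0 = begin
        F (m ℕ.+ i) * E (m ℕ.+ J ∸ (m ℕ.+ i)) ≡⟨ cong (λ k → F (m ℕ.+ i) * E k) (ℕ.[m+n]∸[m+o]≡n∸o m J i) ⟩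
        F (m ℕ.+ i) * E (J ∸ i)               ≡⟨ cong (F (m ℕ.+ i) *_) (radicalSums-< j c (J ∸ i)
                                                   (ℕ.m<n⇒0<n∸m i<J) (ℕ.∸-monoʳ-< (ℕ.n≢0⇒n>0 i≢0) (ℕ.<⇒≤ i<J))) ⟩
        F (m ℕ.+ i) * + 0                     ≡⟨ ℤ.*-zeroʳ (F (m ℕ.+ i)) ⟩
        + 0                                   ∎

  -- the coefficients of (1 - c x^(1+j)) · G
  mulRadicalFactor : ℕ → ℤ → (ℕ → ℤ) → ℕ → ℤ
  mulRadicalFactor j c G n = G n - c * shift (suc j) G n

  mulRadicalFactor-newtonSum-radicalSums : ∀ F j c n →
    mulRadicalFactor j c (newtonSum F (radicalSums j c)) n ≡ shift (suc j) (λ m → + suc j * c * F m) n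
  mulRadicalFactor-newtonSum-radicalSums F j c n with suc j ≤? n
  ... | yes J≤n = begin
    N n - c * N (n ∸ J)                                       ≡⟨ cong (λ k → N k - c * N (n ∸ J)) (sym (ℕ.m+[n∸m]≡n J≤n)) ⟩
    N (J ℕ.+ (n ∸ J)) - c * N (n ∸ J)                         ≡⟨ cong (_- c * N (n ∸ J)) (newtonSum-radicalSums-+ F j c (n ∸ J)) ⟩
    c * N (n ∸ J) + + J * c * F (n ∸ J) - c * N (n ∸ J)       ≡⟨ cancel (c * N (n ∸ J)) _ ⟩
    + J * c * F (n ∸ J)                                       ∎
    where
    J = suc j
    N = newtonSum F (radicalSums j c)
    cancel : ∀ x y → x + y - x ≡ y
    cancel = solve-∀
  ... | no  J≰n = begin
    N n - c * + 0     ≡⟨ cong (_-_ (N n)) (ℤ.*-zeroʳ c) ⟩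
    N n - + 0         ≡⟨ ℤ.+-identityʳ (N n) ⟩
    N n               ≡⟨ ∑-zeros n (λ i i<n → trans (cong (F i *_) (radicalSums-< j c (n ∸ i) (ℕ.m<n⇒0<n∸m i<n)
                                                        (ℕ.≤-<-trans (ℕ.m∸n≤m n i) (ℕ.≰⇒> J≰n))))
                                                  (ℤ.*-zeroʳ (F i))) ⟩
    + 0               ∎
    where
    N = newtonSum F (radicalSums j c)

  newtonSum-mulRadicalFactorˡ : ∀ j c G X n →
    newtonSum (mulRadicalFactor j c G) X n ≡ mulRadicalFactor j c (newtonSum G X) n
  newtonSum-mulRadicalFactorˡ j c G X n =
    trans (newtonSum-linearˡ G (shift (suc j) G) c X n)
          (cong (λ s → newtonSum G X n - c * s) (newtonSum-shiftˡ (suc j) G X n))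

  -- -x F′/F is additive over products, and radicalSums j c is its value for 1 - c x^(1+j)
  newtonDefect-mulRadicalFactor : ∀ j c G P n →
    newtonDefect (mulRadicalFactor j c G) (λ m → P m + radicalSums j c m) n
      ≡ mulRadicalFactor j c (newtonDefect G P) n
  newtonDefect-mulRadicalFactor j c G P n = begin
    newtonSum H (λ m → P m + E m) n + fromℕ n * H n
      ≡⟨ cong (_+ fromℕ n * H n) (newtonSum-distribʳ-+ H P E n) ⟩
    newtonSum H P n + newtonSum H E n + fromℕ n * H n
      ≡⟨ cong₂ (λ x y → x + y + fromℕ n * H n) (newtonSum-mulRadicalFactorˡ j c G P n)
               (trans (newtonSum-mulRadicalFactorˡ j c G E n) (mulRadicalFactor-newtonSum-radicalSums G j c n)) ⟩
    expanded n
      ≡⟨ regroup n ⟩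
    mulRadicalFactor j c (newtonDefect G P) n ∎
    where
    J = suc j
    E = radicalSums j c
    H = mulRadicalFactor j c G
    A = newtonSum G P
    expanded : ℕ → ℤ
    expanded n = A n - c * shift J A n + shift J (λ m → + J * c * G m) n + fromℕ n * (G n - c * shift J G n)
    regroup-+ : ∀ m → expanded (J ℕ.+ m) ≡ mulRadicalFactor j c (newtonDefect G P) (J ℕ.+ m)
    regroup-+ m
      rewrite shift-+ J A m | shift-+ J (λ m → + J * c * G m) m | shift-+ J G m | shift-+ J (newtonDefect G P) m
            | fromℕ≡+ (J ℕ.+ m) | fromℕ≡+ m | ℤ.pos-+ J m
      = identity (A (J ℕ.+ m)) (A m) (G (J ℕ.+ m)) (G m) c (+ J) (+ m)
      where
      identity : ∀ a a′ g g′ c j m → a - c * a′ + j * c * g′ + (j + m) * (g - c * g′)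
                                     ≡ a + (j + m) * g - c * (a′ + m * g′)
      identity = solve-∀
    regroup-< : ∀ {n} → n < J → expanded n ≡ mulRadicalFactor j c (newtonDefect G P) n
    regroup-< {n} n<J
      rewrite shift-< A n<J | shift-< (λ m → + J * c * G m) n<J | shift-< G n<J | shift-< (newtonDefect G P) n<J
      = identity (A n) (G n) c (fromℕ n)
      where
      identity : ∀ a g c k → a - c * + 0 + + 0 + k * (g - c * + 0) ≡ a + k * g - c * + 0
      identity = solve-∀
    regroup : ∀ n → expanded n ≡ mulRadicalFactor j c (newtonDefect G P) n
    regroup n = byCases (ℕ.≤-<-connex J n)
      where
      byCases : J ≤ n ⊎ n < J → expanded n ≡ mulRadicalFactor j c (newtonDefect G P) n
      byCases (inj₁ J≤n) = subst (λ k → expanded k ≡ mulRadicalFactor j c (newtonDefect G P) k)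
                                 (ℕ.m+[n∸m]≡n J≤n) (regroup-+ (n ∸ J))
      byCases (inj₂ n<J) = regroup-< n<J

  mulRadicalFactor-cancel : ∀ j c δ → (∀ n → mulRadicalFactor j c δ n ≡ + 0) → ∀ n → δ n ≡ + 0
  mulRadicalFactor-cancel j c δ factor≡0 = <-rec _ step
    where
    step : ∀ n → WfRec _<_ (λ m → δ m ≡ + 0) n → δ n ≡ + 0
    step n IH = begin
      δ n                                     ≡⟨ solve-for-δ (δ n) (c * shift (suc j) δ n) ⟩
      mulRadicalFactor j c δ n + c * shift (suc j) δ n  ≡⟨ cong₂ (λ x y → x + c * y) (factor≡0 n) shifted≡0 ⟩
      + 0 + c * + 0                           ≡⟨ ℤ.+-identityˡ (c * + 0) ⟩
      c * + 0                                 ≡⟨ ℤ.*-zeroʳ c ⟩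
      + 0                                     ∎
      where
      solve-for-δ : ∀ x y → x ≡ x - y + y
      solve-for-δ = solve-∀
      shifted≡0 : shift (suc j) δ n ≡ + 0
      shifted≡0 with suc j ≤? n
      ... | yes J≤n = IH (ℕ.∸-monoʳ-< {n} {suc j} {0} (s≤s z≤n) J≤n)
      ... | no  _   = refl

  module _ (F : ℕ → ℤ) (j : ℕ) (c : ℤ) where

    private
      step : ∀ n → WfRec _<_ (λ _ → ℤ) n → ℤ
      step n IH with suc j ≤? n
      ... | yes J≤n = F n + c * IH (ℕ.∸-monoʳ-< {n} {suc j} {0} (s≤s z≤n) J≤n)
      ... | no  _   = F n + c * + 0

      step-ext : ∀ n {IH IH′ : WfRec _<_ (λ _ → ℤ) n} →
                 (∀ {m} (m<n : m < n) → IH m<n ≡ IH′ m<n) → step n IH ≡ step n IH′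
      step-ext n IH≡IH′ with suc j ≤? n
      ... | yes J≤n = cong (λ x → F n + c * x) (IH≡IH′ _)
      ... | no  _   = refl

    -- the power series F / (1 - c x^(1+j))
    quotient : ℕ → ℤ
    quotient = <-rec _ step

    quotient-unfold : ∀ n → quotient n ≡ F n + c * shift (suc j) quotient n
    quotient-unfold n = trans (FixPoint.unfold-wfRec <-wellFounded _ step step-ext {n}) unfolded
      where
      unfolded : step n (λ {m} _ → quotient m) ≡ F n + c * shift (suc j) quotient n
      unfolded with suc j ≤? n
      ... | yes _ = refl
      ... | no  _ = refl

    quotient-mulRadicalFactor : ∀ n → F n ≡ mulRadicalFactor j c quotient n
    quotient-mulRadicalFactor n = begin
      F n                                                     ≡⟨ add-sub (F n) (c * shift (suc j) quotient n) ⟩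
      F n + c * shift (suc j) quotient n - c * shift (suc j) quotient n ≡⟨ cong (_- c * shift (suc j) quotient n) (sym (quotient-unfold n)) ⟩
      mulRadicalFactor j c quotient n                         ∎
      where
      add-sub : ∀ x y → x ≡ x + y - y
      add-sub = solve-∀

  powerSums-mulRadicalFactor⁻¹ : ∀ {F G P} j c → (∀ i → F i ≡ mulRadicalFactor j c G i) →
                                 PowerSums F P → PowerSums G (λ m → P m - radicalSums j c m)
  powerSums-mulRadicalFactor⁻¹ {F} {G} {P} j c F≡ psF = mulRadicalFactor-cancel j c _ factor≡0
    where
    E = radicalSums j c
    sub-add : ∀ x y → x - y + y ≡ x
    sub-add = solve-∀
    factor≡0 : ∀ n → mulRadicalFactor j c (newtonDefect G (λ m → P m - E m)) n ≡ + 0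
    factor≡0 n = begin
      mulRadicalFactor j c (newtonDefect G (λ m → P m - E m)) n
        ≡⟨ sym (newtonDefect-mulRadicalFactor j c G (λ m → P m - E m) n) ⟩
      newtonDefect (mulRadicalFactor j c G) (λ m → P m - E m + E m) n
        ≡⟨ cong₂ _+_ (trans (newtonSum-congˡ (λ m → P m - E m + E m) n (λ i → sym (F≡ i)))
                            (newtonSum-congʳ F n (λ m → sub-add (P m) (E m))))
                     (cong (fromℕ n *_) (sym (F≡ n))) ⟩
      newtonDefect F P n
        ≡⟨ psF n ⟩
      + 0 ∎

  module _ (Q : ℕ → ℤ) where

    -- factor k = Q / ∏_{i<k} (1 - radicalCoefficient i · x^(1+i)); its coefficients 1, …, k vanish
    factor : ℕ → ℕ → ℤ
    radicalCoefficient : ℕ → ℤ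

    factor zero    = Q
    factor (suc k) = quotient (factor k) k (radicalCoefficient k)

    radicalCoefficient k = - factor k (suc k)

    factor-zero : Q 0 ≡ + 1 → ∀ k → factor k 0 ≡ + 1
    factor-zero Q₀≡1 zero    = Q₀≡1
    factor-zero Q₀≡1 (suc k) = begin
      factor (suc k) 0                                          ≡⟨ quotient-unfold (factor k) k (radicalCoefficient k) 0 ⟩
      factor k 0 + radicalCoefficient k * shift (suc k) (factor (suc k)) 0
                                                                ≡⟨ cong₂ (λ x y → x + radicalCoefficient k * y)
                                                                         (factor-zero Q₀≡1 k) (shift-< {suc k} {0} (factor (suc k)) (s≤s z≤n)) ⟩
      + 1 + radicalCoefficient k * + 0                          ≡⟨ cong (_+_ (+ 1)) (ℤ.*-zeroʳ (radicalCoefficient k)) ⟩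
      + 1                                                       ∎

    factor-vanish : Q 0 ≡ + 1 → ∀ k i → 1 ≤ i → i ≤ k → factor k i ≡ + 0
    factor-vanish Q₀≡1 zero    (suc i) _ ()
    factor-vanish Q₀≡1 (suc k) i 1≤i i≤1+k with i ℕ.≟ suc k
    ... | yes ≡.refl = begin
      factor (suc k) (suc k)                                    ≡⟨ quotient-unfold (factor k) k (radicalCoefficient k) (suc k) ⟩
      factor k (suc k) + - factor k (suc k) * shift (suc k) (factor (suc k)) (suc k)
                                                                ≡⟨ cong (λ x → factor k (suc k) + - factor k (suc k) * x)
                                                                        (trans (shift-≥ {suc k} {suc k} (factor (suc k)) ℕ.≤-refl)
                                                                               (trans (cong (factor (suc k)) (ℕ.n∸n≡0 (suc k)))
                                                                                      (factor-zero Q₀≡1 (suc k)))) ⟩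
      factor k (suc k) + - factor k (suc k) * + 1               ≡⟨ cancel (factor k (suc k)) ⟩
      + 0                                                       ∎
      where
      cancel : ∀ x → x + - x * + 1 ≡ + 0
      cancel = solve-∀
    ... | no  i≢1+k = begin
      factor (suc k) i                                          ≡⟨ quotient-unfold (factor k) k (radicalCoefficient k) i ⟩
      factor k i + radicalCoefficient k * shift (suc k) (factor (suc k)) i
                                                                ≡⟨ cong₂ (λ x y → x + radicalCoefficient k * y)
                                                                         (factor-vanish Q₀≡1 k i 1≤i i≤k) (shift-< {suc k} {i} (factor (suc k)) (s≤s i≤k)) ⟩
      + 0 + radicalCoefficient k * + 0                          ≡⟨ ℤ.+-identityˡ (radicalCoefficient k * + 0) ⟩
      radicalCoefficient k * + 0                                ≡⟨ ℤ.*-zeroʳ (radicalCoefficient k) ⟩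
      + 0                                                       ∎
      where
      i≤k : i ≤ k
      i≤k = ℕ.≤-pred (ℕ.≤∧≢⇒< i≤1+k i≢1+k)

    residual : (ℕ → ℤ) → ℕ → ℕ → ℤ
    residual T k m = T m - ∑ k (λ i → radicalSums i (radicalCoefficient i) m)

    factor-powerSums : ∀ {T} → PowerSums Q T → ∀ k → PowerSums (factor k) (residual T k)
    factor-powerSums {T} psQ zero    = powerSums-congʳ Q (λ m → sym (ℤ.+-identityʳ (T m))) psQ
    factor-powerSums {T} psQ (suc k) =
      powerSums-congʳ (factor (suc k)) (λ m → regroup (T m) (∑ k (λ i → radicalSums i (radicalCoefficient i) m))
                                                        (radicalSums k (radicalCoefficient k) m))
        (powerSums-mulRadicalFactor⁻¹ {P = residual T k} k (radicalCoefficient k)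
          (quotient-mulRadicalFactor (factor k) k (radicalCoefficient k)) (factor-powerSums {T} psQ k))
      where
      regroup : ∀ t s e → t - s - e ≡ t - (s + e)
      regroup = solve-∀

    radical-decomposition : ∀ {T} → Q 0 ≡ + 1 → PowerSums Q T →
                           ∀ N m → 1 ≤ m → m ≤ N → T m ≡ ∑ N (λ k → radicalSums k (radicalCoefficient k) m)
    radical-decomposition {T} Q₀≡1 psQ N m 1≤m m≤N = ℤ.i-j≡0⇒i≡j _ _
      (powerSums-vanish {X = residual T N} N (factor-zero Q₀≡1 N) (factor-powerSums {T} psQ N) (factor-vanish Q₀≡1 N) m 1≤m m≤N)

module DivisorSum where

  open import Data.Nat.Base as ℕ using (ℕ; zero; suc; _≤_; _<_; s≤s; NonZero)
  import Data.Nat.Properties as ℕ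
  open import Data.Nat.Divisibility as ℕ using (_∣?_)
  open import Data.Integer.Base using (ℤ; +_; _+_; _*_; -_; _-_)
  import Data.Integer.Properties as ℤ
  open import Data.Integer.Divisibility.Signed using (_∣_; divides)
  open import Data.Bool.Base using (if_then_else_)
  open import Relation.Nullary using (¬_; yes; no)
  open import Relation.Nullary.Decidable using (⌊_⌋)
  open import Relation.Binary.PropositionalEquality
  open import Data.Empty using (⊥-elim)
  open IntegerRing
  open ≡-Reasoning

  divisorTerm : ℕ → (ℕ → ℤ) → ℕ → ℤ
  divisorTerm n f k = if ⌊ suc k ∣? n ⌋ then f (suc k) else + 0

  divisorSum : ℕ → (ℕ → ℤ) → ℤ
  divisorSum n f = ∑ n (divisorTerm n f)

  divisorSum-cong : ∀ n {f g} → (∀ k → suc k ℕ.∣ n → f (suc k) ≡ g (suc k)) → divisorSum n f ≡ divisorSum n g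
  divisorSum-cong n {f} {g} f≡g = ∑-cong n termwise
    where
    termwise : ∀ k → k < n → divisorTerm n f k ≡ divisorTerm n g k
    termwise k _ with suc k ∣? n
    ... | yes d∣n = f≡g k d∣n
    ... | no  _   = refl

  divisorSum-zeros : ∀ n {f} → (∀ k → suc k ℕ.∣ n → f (suc k) ≡ + 0) → divisorSum n f ≡ + 0
  divisorSum-zeros n {f} f≡0 = trans (divisorSum-cong n {f} {λ _ → + 0} f≡0) (∑-zeros n termwise)
    where
    termwise : ∀ k → k < n → divisorTerm n (λ _ → + 0) k ≡ + 0
    termwise k _ with suc k ∣? n
    ... | yes _ = refl
    ... | no  _ = refl

  divisorSum-∑ : ∀ n N (G : ℕ → ℕ → ℤ) → divisorSum n (λ d → ∑ N (λ i → G i d)) ≡ ∑ N (λ i → divisorSum n (G i))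
  divisorSum-∑ n N G = trans (∑-cong n (λ k _ → termwise k)) (∑-comm n N (λ k i → divisorTerm n (G i) k))
    where
    termwise : ∀ k → divisorTerm n (λ d → ∑ N (λ i → G i d)) k ≡ ∑ N (λ i → divisorTerm n (G i) k)
    termwise k with suc k ∣? n
    ... | yes _ = refl
    ... | no  _ = sym (∑-zeros N (λ _ _ → refl))

  divisorSum-*ˡ : ∀ n c f → divisorSum n (λ d → c * f d) ≡ c * divisorSum n f
  divisorSum-*ˡ n c f = trans (∑-cong n (λ k _ → termwise k)) (sym (*-distribˡ-∑ n c (divisorTerm n f)))
    where
    termwise : ∀ k → divisorTerm n (λ d → c * f d) k ≡ c * divisorTerm n f k
    termwise k with suc k ∣? n
    ... | yes _ = refl
    ... | no  _ = sym (ℤ.*-zeroʳ c)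

  divisorSum-+ : ∀ n f g → divisorSum n (λ d → f d + g d) ≡ divisorSum n f + divisorSum n g
  divisorSum-+ n f g = trans (∑-cong n (λ k _ → termwise k)) (∑-distrib-+ n _ _)
    where
    termwise : ∀ k → divisorTerm n (λ d → f d + g d) k ≡ divisorTerm n f k + divisorTerm n g k
    termwise k with suc k ∣? n
    ... | yes _ = refl
    ... | no  _ = refl

  divisorSum-neg : ∀ n f → divisorSum n (λ d → - f d) ≡ - divisorSum n f
  divisorSum-neg n f = trans (∑-cong n (λ k _ → termwise k)) (∑-neg n _)
    where
    termwise : ∀ k → divisorTerm n (λ d → - f d) k ≡ - divisorTerm n f k
    termwise k with suc k ∣? n
    ... | yes _ = refl
    ... | no  _ = refl

  divisorSum-sub : ∀ n f g → divisorSum n (λ d → f d - g d) ≡ divisorSum n f - divisorSum n g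
  divisorSum-sub n f g = trans (divisorSum-+ n f (λ d → - g d)) (cong (_+_ (divisorSum n f)) (divisorSum-neg n g))

  divisorSum-∣ : ∀ {a} n f → (∀ k → suc k ℕ.∣ n → a ∣ f (suc k)) → a ∣ divisorSum n f
  divisorSum-∣ {a} n f a∣f = ∑-∣ n _ termwise
    where
    termwise : ∀ k → k < n → a ∣ divisorTerm n f k
    termwise k _ with suc k ∣? n
    ... | yes d∣n = a∣f k d∣n
    ... | no  _   = divides (+ 0) refl

  divisorSum-restrict : ∀ {n N} f → .{{NonZero n}} → .{{NonZero N}} → n ℕ.∣ N →
                        (∀ k → suc k ℕ.∣ N → ¬ suc k ℕ.∣ n → f (suc k) ≡ + 0) → divisorSum N f ≡ divisorSum n f
  divisorSum-restrict {n} {N} f n∣N f≡0 = begin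
    ∑ N (divisorTerm N f)   ≡⟨ ∑-truncate n N _ (ℕ.∣⇒≤ n∣N) beyond ⟩
    ∑ n (divisorTerm N f)   ≡⟨ ∑-cong n (λ k _ → within k) ⟩
    ∑ n (divisorTerm n f)   ∎
    where
    within : ∀ k → divisorTerm N f k ≡ divisorTerm n f k
    within k with suc k ∣? N | suc k ∣? n
    ... | yes _   | yes _   = refl
    ... | yes d∣N | no  d∤n = f≡0 k d∣N d∤n
    ... | no  d∤N | yes d∣n = ⊥-elim (d∤N (ℕ.∣-trans d∣n n∣N))
    ... | no  _   | no  _   = refl
    beyond : ∀ k → n ≤ k → k < N → divisorTerm N f k ≡ + 0
    beyond k n≤k _ with suc k ∣? N | suc k ∣? n
    ... | yes d∣N | yes d∣n = ⊥-elim (ℕ.<⇒≱ (s≤s n≤k) (ℕ.∣⇒≤ d∣n))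
    ... | yes d∣N | no  d∤n = f≡0 k d∣N d∤n
    ... | no  _   | _       = refl

  primeTo : ℕ → (ℕ → ℤ) → ℕ → ℤ
  primeTo p f d = if ⌊ p ∣? d ⌋ then + 0 else f d

  multiplesOf : ℕ → (ℕ → ℤ) → ℕ → ℤ
  multiplesOf p f d = if ⌊ p ∣? d ⌋ then f d else + 0

  ∑-multiples : ∀ q M h → ∑ (M ℕ.* suc q) (λ k → multiplesOf (suc q) h (suc k)) ≡ ∑ M (λ t → h (suc t ℕ.* suc q))
  ∑-multiples q zero    h = refl
  ∑-multiples q (suc M) h = begin
    ∑ (p ℕ.+ M ℕ.* p) F                          ≡⟨ cong (λ n → ∑ n F) (ℕ.+-comm p (M ℕ.* p)) ⟩
    ∑ (M ℕ.* p ℕ.+ p) F                          ≡⟨ ∑-split (M ℕ.* p) p F ⟩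
    ∑ (M ℕ.* p) F + ∑ p (λ i → F (M ℕ.* p ℕ.+ i)) ≡⟨ cong₂ _+_ (∑-multiples q M h) block ⟩
    ∑ M (λ t → h (suc t ℕ.* p)) + h (suc M ℕ.* p) ∎
    where
    p = suc q
    F = λ k → multiplesOf p h (suc k)
    last : suc (M ℕ.* p ℕ.+ q) ≡ suc M ℕ.* p
    last = trans (sym (ℕ.+-suc (M ℕ.* p) q)) (ℕ.+-comm (M ℕ.* p) p)
    block : ∑ p (λ i → F (M ℕ.* p ℕ.+ i)) ≡ h (suc M ℕ.* p)
    block = trans (∑-single p q _ ℕ.≤-refl others) top
      where
      others : ∀ i → i < p → ¬ i ≡ q → F (M ℕ.* p ℕ.+ i) ≡ + 0
      others i i<p i≢q with p ∣? suc (M ℕ.* p ℕ.+ i)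
      ... | no  _ = refl
      ... | yes p∣ = ⊥-elim (ℕ.<⇒≱ (s≤s (ℕ.≤∧≢⇒< (ℕ.≤-pred i<p) i≢q)) (ℕ.∣⇒≤ p∣1+i))
        where
        p∣1+i : p ℕ.∣ suc i
        p∣1+i = ℕ.∣m+n∣m⇒∣n (subst (p ℕ.∣_) (sym (ℕ.+-suc (M ℕ.* p) i)) p∣) (ℕ.n∣m*n M)
      top : F (M ℕ.* p ℕ.+ q) ≡ h (suc M ℕ.* p)
      top with p ∣? suc (M ℕ.* p ℕ.+ q)
      ... | yes _   = cong h last
      ... | no  p∤ = ⊥-elim (p∤ (subst (p ℕ.∣_) (sym last) (ℕ.n∣m*n (suc M))))

  divisorSum-multiplesOf : ∀ p .{{_ : NonZero p}} M f → divisorSum (M ℕ.* p) (multiplesOf p f) ≡ divisorSum M (λ t → f (t ℕ.* p))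
  divisorSum-multiplesOf (suc q) M f = begin
    ∑ N (divisorTerm N (multiplesOf p f))                                ≡⟨ ∑-cong N (λ k _ → swap k) ⟩
    ∑ N (λ k → multiplesOf p divisorsOfN (suc k))                        ≡⟨ ∑-multiples q M divisorsOfN ⟩
    ∑ M (λ t → divisorsOfN (suc t ℕ.* p))                                ≡⟨ ∑-cong M (λ t _ → cancel t) ⟩
    divisorSum M (λ t → f (t ℕ.* p))                                   ∎
    where
    p = suc q
    N = M ℕ.* p
    divisorsOfN : ℕ → ℤ
    divisorsOfN d = if ⌊ d ∣? N ⌋ then f d else + 0
    swap : ∀ k → divisorTerm N (multiplesOf p f) k ≡ multiplesOf p divisorsOfN (suc k)
    swap k with suc k ∣? N | p ∣? suc k
    ... | yes _ | yes _ = refl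
    ... | yes _ | no  _ = refl
    ... | no  _ | yes _ = refl
    ... | no  _ | no  _ = refl
    cancel : ∀ t → divisorsOfN (suc t ℕ.* p) ≡ divisorTerm M (λ t → f (t ℕ.* p)) t
    cancel t with suc t ℕ.* p ∣? N | suc t ∣? M
    ... | yes _       | yes _     = refl
    ... | yes tp∣Mp   | no  t∤M   = ⊥-elim (t∤M (ℕ.*-cancelʳ-∣ p tp∣Mp))
    ... | no  tp∤Mp   | yes t∣M   = ⊥-elim (tp∤Mp (ℕ.*-monoˡ-∣ p t∣M))
    ... | no  _       | no  _     = refl

  divisorSum-splitBy : ∀ p .{{_ : NonZero p}} M (f : ℕ → ℤ) →
                       divisorSum (M ℕ.* p) f ≡ divisorSum (M ℕ.* p) (primeTo p f) + divisorSum M (λ t → f (t ℕ.* p))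
  divisorSum-splitBy p M f = begin
    divisorSum (M ℕ.* p) f
      ≡⟨ divisorSum-cong (M ℕ.* p) {f} {λ d → primeTo p f d + multiplesOf p f d} (λ k _ → split (suc k)) ⟩
    divisorSum (M ℕ.* p) (λ d → primeTo p f d + multiplesOf p f d)
      ≡⟨ divisorSum-+ (M ℕ.* p) (primeTo p f) (multiplesOf p f) ⟩
    divisorSum (M ℕ.* p) (primeTo p f) + divisorSum (M ℕ.* p) (multiplesOf p f)
      ≡⟨ cong (_+_ (divisorSum (M ℕ.* p) (primeTo p f))) (divisorSum-multiplesOf p M f) ⟩
    divisorSum (M ℕ.* p) (primeTo p f) + divisorSum M (λ t → f (t ℕ.* p)) ∎
    where
    split : ∀ d → f d ≡ primeTo p f d + multiplesOf p f d
    split d with p ∣? d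
    ... | yes _ = sym (ℤ.+-identityˡ (f d))
    ... | no  _ = sym (ℤ.+-identityʳ (f d))

module DoldSums where

  open import Data.Nat.Base as ℕ using (ℕ; zero; suc; _≤_; z≤n; s≤s; NonZero)
  import Data.Nat.Properties as ℕ
  open import Data.Nat.DivMod using (_/_; m≥n⇒m/n>0; m/n≤m; *-/-assoc; m*n/n≡m)
  open import Data.Nat.Divisibility as ℕ using (_∣?_; divides; m∣m*n; n∣m*n; m/n∣m; m∣n/o⇒o*m∣n; *-cancelˡ-∣)
  open import Data.Integer.Base using (ℤ; +_; _+_; _*_; _^_)
  import Data.Integer.Properties as ℤ
  open import Data.Integer.Divisibility.Signed as ℤ using (_∣_; ∣⇒∣ᵤ; ∣ᵤ⇒∣; *-monoʳ-∣)
  open import Data.Integer.Divisibility using () renaming (_∣_ to _ℤ∣ᵤ_)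
  open import Algebra.Properties.CommutativeSemigroup ℤ.*-commutativeSemigroup using (x∙yz≈y∙xz)
  open import Relation.Nullary using (¬_; yes; no)
  open import Relation.Binary.PropositionalEquality hiding (J)
  open import Data.Empty using (⊥-elim)
  open IntegerRing
  open DivisorSum
  open RadicalDecomposition using (radicalSums; radicalCoefficient; radical-decomposition)
  open ≡-Reasoning

  Σℤ≡∑ : ∀ n f → Σℤ n f ≡ ∑ n f
  Σℤ≡∑ zero    f = refl
  Σℤ≡∑ (suc n) f = cong (_+ f n) (Σℤ≡∑ n f)

  -- μ(d) · A(n / d); the junk value at d = 0 is never used by divisorSum
  möbiusTerm : (ℕ → ℤ) → ℕ → ℕ → ℤ
  möbiusTerm A n zero    = + 0
  möbiusTerm A n (suc k) = μ (suc k) * A (n / suc k)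

  doldSum≡divisorSum : ∀ A n → doldSum A n ≡ divisorSum n (möbiusTerm A n)
  doldSum≡divisorSum A n = Σℤ≡∑ n _

  doldSum-cong : ∀ {A B} n → (∀ m → 1 ≤ m → m ≤ n → A m ≡ B m) → doldSum A n ≡ doldSum B n
  doldSum-cong zero    _   = refl
  doldSum-cong {A} {B} n@(suc _) A≡B = begin
    doldSum A n                      ≡⟨ doldSum≡divisorSum A n ⟩
    divisorSum n (möbiusTerm A n)    ≡⟨ divisorSum-cong n {möbiusTerm A n} {möbiusTerm B n} (λ k k∣n → cong (μ (suc k) *_)
                                          (A≡B (n / suc k) (m≥n⇒m/n>0 (ℕ.∣⇒≤ k∣n)) (m/n≤m n (suc k)))) ⟩
    divisorSum n (möbiusTerm B n)    ≡⟨ sym (doldSum≡divisorSum B n) ⟩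
    doldSum B n                      ∎

  doldSum-∑ : ∀ N (G : ℕ → ℕ → ℤ) n → doldSum (λ m → ∑ N (λ i → G i m)) n ≡ ∑ N (λ i → doldSum (G i) n)
  doldSum-∑ N G n = begin
    doldSum ∑G n
      ≡⟨ doldSum≡divisorSum ∑G n ⟩
    divisorSum n (möbiusTerm ∑G n)
      ≡⟨ divisorSum-cong n {möbiusTerm ∑G n} {λ d → ∑ N (λ i → möbiusTerm (G i) n d)}
                         (λ k _ → *-distribˡ-∑ N (μ (suc k)) (λ i → G i (n / suc k))) ⟩
    divisorSum n (λ d → ∑ N (λ i → möbiusTerm (G i) n d))    ≡⟨ divisorSum-∑ n N (λ i → möbiusTerm (G i) n) ⟩
    ∑ N (λ i → divisorSum n (möbiusTerm (G i) n))            ≡⟨ ∑-cong N (λ i _ → sym (doldSum≡divisorSum (G i) n)) ⟩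
    ∑ N (λ i → doldSum (G i) n)                              ∎
    where
    ∑G = λ m → ∑ N (λ i → G i m)

  doldSum-*ˡ : ∀ c A n → doldSum (λ m → c * A m) n ≡ c * doldSum A n
  doldSum-*ˡ c A n = begin
    doldSum (λ m → c * A m) n                       ≡⟨ doldSum≡divisorSum (λ m → c * A m) n ⟩
    divisorSum n (möbiusTerm (λ m → c * A m) n)
      ≡⟨ divisorSum-cong n {möbiusTerm (λ m → c * A m) n} {λ d → c * möbiusTerm A n d}
                         (λ k _ → x∙yz≈y∙xz (μ (suc k)) c (A (n / suc k))) ⟩
    divisorSum n (λ d → c * möbiusTerm A n d)       ≡⟨ divisorSum-*ˡ n c (möbiusTerm A n) ⟩
    c * divisorSum n (möbiusTerm A n)               ≡⟨ cong (c *_) (sym (doldSum≡divisorSum A n)) ⟩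
    c * doldSum A n                                 ∎
    where

  radicalSums-multiple : ∀ j c t → radicalSums j c (suc j ℕ.* t) ≡ + suc j * c ^ t
  radicalSums-multiple j c t with suc j ∣? (suc j ℕ.* t)
  ... | yes _   = cong (λ e → + suc j * c ^ e) (trans (cong (_/ suc j) (ℕ.*-comm (suc j) t)) (m*n/n≡m t (suc j)))
  ... | no  J∤J = ⊥-elim (J∤J (m∣m*n t))

  radicalSums-nonmultiple : ∀ j c {m} → ¬ suc j ℕ.∣ m → radicalSums j c m ≡ + 0
  radicalSums-nonmultiple j c {m} J∤m with suc j ∣? m
  ... | yes J∣m = ⊥-elim (J∤m J∣m)
  ... | no  _   = refl

  doldSum-radicalSums-multiple : ∀ j c m → .{{NonZero m}} →
    doldSum (radicalSums j c) (suc j ℕ.* m) ≡ + suc j * doldSum (c ^_) m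
  doldSum-radicalSums-multiple j c m = begin
    doldSum E (J ℕ.* m)                            ≡⟨ doldSum≡divisorSum E (J ℕ.* m) ⟩
    divisorSum (J ℕ.* m) (möbiusTerm E (J ℕ.* m))  ≡⟨ divisorSum-restrict (möbiusTerm E (J ℕ.* m)) (n∣m*n J) outside ⟩
    divisorSum m (möbiusTerm E (J ℕ.* m))
      ≡⟨ divisorSum-cong m {möbiusTerm E (J ℕ.* m)} {λ d → + J * möbiusTerm (c ^_) m d} inside ⟩
    divisorSum m (λ d → + J * möbiusTerm (c ^_) m d) ≡⟨ divisorSum-*ˡ m (+ J) (möbiusTerm (c ^_) m) ⟩
    + J * divisorSum m (möbiusTerm (c ^_) m)       ≡⟨ cong (+ J *_) (sym (doldSum≡divisorSum (c ^_) m)) ⟩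
    + J * doldSum (c ^_) m                         ∎
    where
    J = suc j
    E = radicalSums j c
    instance
      Jm≢0 : NonZero (J ℕ.* m)
      Jm≢0 = ℕ.m*n≢0 J m
    outside : ∀ k → suc k ℕ.∣ J ℕ.* m → ¬ suc k ℕ.∣ m → möbiusTerm E (J ℕ.* m) (suc k) ≡ + 0
    outside k k∣Jm k∤m = trans (cong (μ (suc k) *_) (radicalSums-nonmultiple j c J∤quotient)) (ℤ.*-zeroʳ (μ (suc k)))
      where
      J∤quotient : ¬ J ℕ.∣ (J ℕ.* m / suc k)
      J∤quotient J∣q = k∤m (*-cancelˡ-∣ J (subst (ℕ._∣ J ℕ.* m) (ℕ.*-comm (suc k) J) (m∣n/o⇒o*m∣n k∣Jm J∣q)))
    inside : ∀ k → suc k ℕ.∣ m → möbiusTerm E (J ℕ.* m) (suc k) ≡ + J * möbiusTerm (c ^_) m (suc k)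
    inside k k∣m = begin
      μ (suc k) * E (J ℕ.* m / suc k)           ≡⟨ cong (λ t → μ (suc k) * E t) (*-/-assoc J k∣m) ⟩
      μ (suc k) * E (J ℕ.* (m / suc k))         ≡⟨ cong (μ (suc k) *_) (radicalSums-multiple j c (m / suc k)) ⟩
      μ (suc k) * (+ J * c ^ (m / suc k))       ≡⟨ x∙yz≈y∙xz (μ (suc k)) (+ J) (c ^ (m / suc k)) ⟩
      + J * (μ (suc k) * c ^ (m / suc k))       ∎

  doldSum-radicalSums-nonmultiple : ∀ j c {n} → ¬ suc j ℕ.∣ n → doldSum (radicalSums j c) n ≡ + 0
  doldSum-radicalSums-nonmultiple j c {n} J∤n =
    trans (doldSum≡divisorSum (radicalSums j c) n) (divisorSum-zeros n {möbiusTerm (radicalSums j c) n} termwise)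
    where
    termwise : ∀ k → suc k ℕ.∣ n → möbiusTerm (radicalSums j c) n (suc k) ≡ + 0
    termwise k k∣n = trans (cong (μ (suc k) *_) (radicalSums-nonmultiple j c (λ J∣q → J∤n (ℕ.∣-trans J∣q (m/n∣m k∣n)))))
                           (ℤ.*-zeroʳ (μ (suc k)))

  radicalSums-dold : ∀ j c → DoldCondition (c ^_) → DoldCondition (radicalSums j c)
  radicalSums-dold j c powers-dold n 1≤n with suc j ∣? n
  ... | no  J∤n = ∣⇒∣ᵤ (subst (+ n ∣_) (sym (doldSum-radicalSums-nonmultiple j c J∤n)) (ℤ.divides (+ 0) refl))
  ... | yes (divides m@(suc _) refl) =
    ∣⇒∣ᵤ (subst₂ _∣_ n≡ (sym sum≡) (*-monoʳ-∣ (+ suc j) (∣ᵤ⇒∣ {+ m} (powers-dold m (s≤s z≤n)))))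
    where
    n≡ : + suc j * + m ≡ + (m ℕ.* suc j)
    n≡ = trans (sym (ℤ.pos-* (suc j) m)) (cong +_ (ℕ.*-comm (suc j) m))
    sum≡ : doldSum (radicalSums j c) (m ℕ.* suc j) ≡ + suc j * doldSum (c ^_) m
    sum≡ = trans (cong (doldSum (radicalSums j c)) (ℕ.*-comm m (suc j))) (doldSum-radicalSums-multiple j c m)

  powerSums-dold : ∀ {Q T} → Q 0 ≡ + 1 → PowerSums Q T → (∀ c → DoldCondition (c ^_)) → DoldCondition T
  powerSums-dold {Q} {T} Q₀≡1 psQ powers-dold n 1≤n =
    ∣⇒∣ᵤ (subst (+ n ∣_) (sym decomposed)
      (∑-∣ n _ (λ k _ → ∣ᵤ⇒∣ (radicalSums-dold k (c k) (powers-dold (c k)) n 1≤n))))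
    where
    c = radicalCoefficient Q
    decomposed : doldSum T n ≡ ∑ n (λ k → doldSum (radicalSums k (c k)) n)
    decomposed = trans (doldSum-cong {T} n (λ m 1≤m m≤n → radical-decomposition Q {T} Q₀≡1 psQ n m 1≤m m≤n))
                       (doldSum-∑ n (λ k → radicalSums k (c k)) n)

  dold-cong : ∀ {A B} → (∀ n → A n ≡ B n) → DoldCondition A → DoldCondition B
  dold-cong {A} {B} A≡B doldA n 1≤n = subst (λ s → + n ℤ∣ᵤ s) (doldSum-cong n (λ m _ _ → A≡B m)) (doldA n 1≤n)

  dold-*ˡ : ∀ c {A} → DoldCondition A → DoldCondition (λ n → c * A n)
  dold-*ˡ c {A} doldA n 1≤n =
    subst (λ s → + n ℤ∣ᵤ s) (sym (doldSum-*ˡ c A n)) (∣⇒∣ᵤ (ℤ.∣n⇒∣m*n c (∣ᵤ⇒∣ {+ n} (doldA n 1≤n))))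

module Möbius where

  open import Data.Nat.Base as ℕ using (ℕ; zero; suc; _≤_; _<_; z≤n; s≤s; NonZero)
  import Data.Nat.Properties as ℕ
  open import Data.Nat.Divisibility as ℕ using (_∣_; _∣?_)
  open import Data.Nat.Primality using (Prime; prime?; euclidsLemma; prime⇒irreducible; prime⇒nonZero; ¬prime[0]; ¬prime[1])
  open import Data.Nat.Coprimality using (Coprime; coprime-divisor)
  open import Data.Integer.Base using (+_; -_)
  open import Data.List.Base using (List; []; _∷_; _++_; length; filter; upTo; map; foldr)
  open import Data.Bool.ListAction using (any)
  open import Data.List.Properties using (length-++; upTo-∷ʳ)
  import Data.List.Properties as List
  open import Data.List.Relation.Unary.Any.Properties using (any⁺; any⁻; map⁺; map⁻; applyUpTo⁺; applyUpTo⁻)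
  open import Data.Bool.Base using (Bool; true; false; T; _∨_)
  open import Data.Product.Base using (Σ; _×_; _,_; proj₂)
  open import Data.Sum.Base using (_⊎_; inj₁; inj₂; [_,_]; reduce)
  open import Data.Empty using (⊥-elim)
  open import Function.Base using (_∘_)
  open import Relation.Unary using (Pred; Decidable)
  open import Relation.Nullary using (¬_; yes; no)
  open import Relation.Nullary.Decidable using (⌊_⌋; toWitness; fromWitness; _×-dec_; _⊎-dec_)
  open import Relation.Binary.PropositionalEquality hiding ([_])

  count : ∀ {ℓ} {P : Pred ℕ ℓ} → Decidable P → ℕ → ℕ
  count P? N = length (filter P? (upTo N))

  module _ {ℓ} {P : Pred ℕ ℓ} (P? : Decidable P) where

    count-suc : ∀ N → count P? (suc N) ≡ count P? N ℕ.+ length (filter P? (N ∷ []))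
    count-suc N = begin
      length (filter P? (upTo (suc N)))              ≡⟨ cong (length ∘ filter P?) (sym (upTo-∷ʳ N)) ⟩
      length (filter P? (upTo N ++ N ∷ []))          ≡⟨ cong length (List.filter-++ P? (upTo N) (N ∷ [])) ⟩
      length (filter P? (upTo N) ++ filter P? (N ∷ [])) ≡⟨ length-++ (filter P? (upTo N)) ⟩
      count P? N ℕ.+ length (filter P? (N ∷ []))      ∎
      where open ≡-Reasoning

    count-suc-yes : ∀ {N} → P N → count P? (suc N) ≡ suc (count P? N)
    count-suc-yes {N} PN = trans (count-suc N)
      (trans (cong (λ xs → count P? N ℕ.+ length xs) (List.filter-accept P? PN)) (ℕ.+-comm _ 1))

    count-suc-no : ∀ {N} → ¬ P N → count P? (suc N) ≡ count P? N
    count-suc-no {N} ¬PN = trans (count-suc N)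
      (trans (cong (λ xs → count P? N ℕ.+ length xs) (List.filter-reject P? ¬PN)) (ℕ.+-identityʳ _))

    count-extend : ∀ M N → M ≤ N → (∀ i → M ≤ i → i < N → ¬ P i) → count P? N ≡ count P? M
    count-extend M zero    z≤n _    = refl
    count-extend M (suc N) M≤1+N ¬P with M ℕ.≟ suc N
    ... | yes refl = refl
    ... | no  M≢1+N = trans (count-suc-no (¬P N M≤N (ℕ.n<1+n N)))
                            (count-extend M N M≤N (λ i M≤i i<N → ¬P i M≤i (ℕ.m<n⇒m<1+n i<N)))
      where
      M≤N : M ≤ N
      M≤N = ℕ.≤-pred (ℕ.≤∧≢⇒< M≤1+N M≢1+N)

  count-cong : ∀ {ℓ} {P Q : Pred ℕ ℓ} (P? : Decidable P) (Q? : Decidable Q) N →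
               (∀ i → i < N → P i → Q i) → (∀ i → i < N → Q i → P i) → count P? N ≡ count Q? N
  count-cong P? Q? zero    _   _   = refl
  count-cong P? Q? (suc N) P⇒Q Q⇒P with P? N
  ... | yes PN = trans (count-suc-yes P? PN) (trans (cong suc IH) (sym (count-suc-yes Q? (P⇒Q N (ℕ.n<1+n N) PN))))
    where IH = count-cong P? Q? N (λ i i<N → P⇒Q i (ℕ.m<n⇒m<1+n i<N)) (λ i i<N → Q⇒P i (ℕ.m<n⇒m<1+n i<N))
  ... | no ¬PN = trans (count-suc-no P? ¬PN) (trans IH (sym (count-suc-no Q? (¬PN ∘ Q⇒P N (ℕ.n<1+n N)))))
    where IH = count-cong P? Q? N (λ i i<N → P⇒Q i (ℕ.m<n⇒m<1+n i<N)) (λ i i<N → Q⇒P i (ℕ.m<n⇒m<1+n i<N))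

  count-insert : ∀ {ℓ} {P : Pred ℕ ℓ} (P? : Decidable P) {p} N → ¬ P p → p < N →
                 count (λ i → P? i ⊎-dec (i ℕ.≟ p)) N ≡ suc (count P? N)
  count-insert {P = P} P? {p} (suc N) ¬Pp p<1+N with p ℕ.≟ N
  ... | yes refl = trans (count-suc-yes Q? (inj₂ refl))
                         (cong suc (trans (count-cong Q? P? p Q⇒P (λ _ _ → inj₁)) (sym (count-suc-no P? ¬Pp))))
    where
    Q? = λ i → P? i ⊎-dec (i ℕ.≟ p)
    Q⇒P : ∀ i → i < p → P i ⊎ i ≡ p → P i
    Q⇒P i i<p (inj₁ Pi)   = Pi
    Q⇒P i i<p (inj₂ refl) = ⊥-elim (ℕ.<-irrefl refl i<p)
  ... | no  p≢N with P? N
  ...   | yes PN  = trans (count-suc-yes Q? (inj₁ PN)) (trans (cong suc IH) (cong suc (sym (count-suc-yes P? PN))))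
    where
    Q? = λ i → P? i ⊎-dec (i ℕ.≟ p)
    IH = count-insert P? N ¬Pp (ℕ.≤∧≢⇒< (ℕ.≤-pred p<1+N) p≢N)
  ...   | no  ¬PN = trans (count-suc-no Q? [ ¬PN , (p≢N ∘ sym) ]) (trans IH (cong suc (sym (count-suc-no P? ¬PN))))
    where
    Q? = λ i → P? i ⊎-dec (i ℕ.≟ p)
    IH = count-insert P? N ¬Pp (ℕ.≤∧≢⇒< (ℕ.≤-pred p<1+N) p≢N)

  T-injective : ∀ {a b : Bool} → (T a → T b) → (T b → T a) → a ≡ b
  T-injective {false} {false} _ _ = refl
  T-injective {false} {true}  _ b⇒a = ⊥-elim (b⇒a _)
  T-injective {true}  {false} a⇒b _ = ⊥-elim (a⇒b _)
  T-injective {true}  {true}  _ _ = refl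

  HasSquareDivisor : ℕ → Set
  HasSquareDivisor n = Σ ℕ λ i → i < n × suc (suc i) ℕ.* suc (suc i) ∣ n

  private
    foldr-∨≡any : ∀ (f : ℕ → Bool) xs → foldr (λ k b → f k ∨ b) false xs ≡ any f xs
    foldr-∨≡any f []       = refl
    foldr-∨≡any f (x ∷ xs) = cong (f x ∨_) (foldr-∨≡any f xs)

  module _ (n : ℕ) where

    private
      isSquareDivisor : ℕ → Bool
      isSquareDivisor k = ⌊ k ℕ.* k ∣? n ⌋
      candidates : List ℕ
      candidates = map (λ i → suc (suc i)) (upTo n)

    hasSquareFactor-sound : T (hasSquareFactor n) → HasSquareDivisor n
    hasSquareFactor-sound hsf
      with applyUpTo⁻ (λ i → i) (map⁻ (any⁻ isSquareDivisor candidates (subst T (foldr-∨≡any isSquareDivisor candidates) hsf)))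
    ... | i , i<n , k²∣n = i , i<n , toWitness k²∣n

    hasSquareFactor-complete : HasSquareDivisor n → T (hasSquareFactor n)
    hasSquareFactor-complete (i , i<n , k²∣n) = subst T (sym (foldr-∨≡any isSquareDivisor candidates))
      (any⁺ isSquareDivisor (map⁺ (applyUpTo⁺ (λ i → i) (fromWitness k²∣n) i<n)))

  private
    primeDivisor? : ∀ n → Decidable (λ i → Prime i × i ∣ n)
    primeDivisor? n i = prime? i ×-dec (i ∣? n)

    nonDivisible⇒nonZero : ∀ {p t} → ¬ p ∣ t → NonZero t
    nonDivisible⇒nonZero {p} {zero}  p∤0 = ⊥-elim (p∤0 (p ℕ.∣0))
    nonDivisible⇒nonZero {t = suc _} _   = _

  module _ {p t} (pp : Prime p) (p∤t : ¬ p ∣ t) where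

    private
      instance
        t≢0 : NonZero t
        t≢0 = nonDivisible⇒nonZero p∤t
        p≢0 : NonZero p
        p≢0 = prime⇒nonZero pp

      square-coprime : ∀ {k} → k ℕ.* k ∣ p ℕ.* t → Coprime (k ℕ.* k) p
      square-coprime {k} k²∣pt {d} (d∣k² , d∣p) with prime⇒irreducible pp d∣p
      ... | inj₁ d≡1 = d≡1
      ... | inj₂ refl = ⊥-elim (p∤t (ℕ.*-cancelˡ-∣ p (ℕ.∣-trans p²∣k² k²∣pt)))
        where
        p∣k : p ∣ k
        p∣k = reduce (euclidsLemma k k pp d∣k²)
        p²∣k² : p ℕ.* p ∣ k ℕ.* k
        p²∣k² = ℕ.*-pres-∣ p∣k p∣k

    hasSquareFactor-coprime : hasSquareFactor (p ℕ.* t) ≡ hasSquareFactor t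
    hasSquareFactor-coprime = T-injective
      (λ hsf → hasSquareFactor-complete t (drop-p (hasSquareFactor-sound (p ℕ.* t) hsf)))
      (λ hsf → hasSquareFactor-complete (p ℕ.* t) (add-p (hasSquareFactor-sound t hsf)))
      where
      drop-p : HasSquareDivisor (p ℕ.* t) → HasSquareDivisor t
      drop-p (i , _ , k²∣pt) = i , i<t , k²∣t
        where
        k²∣t : suc (suc i) ℕ.* suc (suc i) ∣ t
        k²∣t = coprime-divisor (square-coprime {suc (suc i)} k²∣pt) k²∣pt
        i<t : i < t
        i<t = ℕ.<-≤-trans (ℕ.≤-trans (ℕ.n≤1+n (suc i)) (ℕ.m≤m*n (suc (suc i)) (suc (suc i)))) (ℕ.∣⇒≤ k²∣t)
      add-p : HasSquareDivisor t → HasSquareDivisor (p ℕ.* t)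
      add-p (i , i<t , k²∣t) = i , ℕ.<-≤-trans i<t (ℕ.m≤n*m t p) , ℕ.∣n⇒∣m*n p k²∣t

    numPrimeDivisors-coprime : numPrimeDivisors (p ℕ.* t) ≡ suc (numPrimeDivisors t)
    numPrimeDivisors-coprime = begin
      count (primeDivisor? (p ℕ.* t)) (suc (p ℕ.* t))
        ≡⟨ count-cong (primeDivisor? (p ℕ.* t)) (λ i → primeDivisor? t i ⊎-dec (i ℕ.≟ p)) (suc (p ℕ.* t))
                      (λ i _ → split) (λ i _ → merge) ⟩
      count (λ i → primeDivisor? t i ⊎-dec (i ℕ.≟ p)) (suc (p ℕ.* t))
        ≡⟨ count-insert (primeDivisor? t) (suc (p ℕ.* t)) (p∤t ∘ proj₂) (s≤s (ℕ.m≤m*n p t)) ⟩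
      suc (count (primeDivisor? t) (suc (p ℕ.* t)))
        ≡⟨ cong suc (count-extend (primeDivisor? t) (suc t) (suc (p ℕ.* t)) (s≤s (ℕ.m≤n*m t p))
                                  (λ i t<i _ (_ , i∣t) → ℕ.<⇒≱ t<i (ℕ.∣⇒≤ i∣t))) ⟩
      suc (count (primeDivisor? t) (suc t)) ∎
      where
      open ≡-Reasoning
      split : ∀ {i} → Prime i × i ∣ p ℕ.* t → (Prime i × i ∣ t) ⊎ i ≡ p
      split {i} (pi , i∣pt) with euclidsLemma p t pi i∣pt
      ... | inj₂ i∣t = inj₁ (pi , i∣t)
      ... | inj₁ i∣p with prime⇒irreducible pp i∣p
      ...   | inj₁ refl = ⊥-elim (¬prime[1] pi)
      ...   | inj₂ i≡p  = inj₂ i≡p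
      merge : ∀ {i} → (Prime i × i ∣ t) ⊎ i ≡ p → Prime i × i ∣ p ℕ.* t
      merge (inj₁ (pi , i∣t)) = pi , ℕ.∣n⇒∣m*n p i∣t
      merge (inj₂ refl)       = pp , ℕ.m∣m*n t

    μ-*-coprime : μ (p ℕ.* t) ≡ - μ t
    μ-*-coprime rewrite hasSquareFactor-coprime | numPrimeDivisors-coprime with hasSquareFactor t
    ... | true  = refl
    ... | false = refl

  μ-square : ∀ {n} → HasSquareDivisor n → μ n ≡ + 0
  μ-square {n} sq with hasSquareFactor n | hasSquareFactor-complete n sq
  ... | true  | _  = refl
  ... | false | ()

  μ-*-dividing : ∀ {p t} .{{_ : NonZero t}} → Prime p → p ∣ t → μ (p ℕ.* t) ≡ + 0
  μ-*-dividing {zero}        pp _   = ⊥-elim (¬prime[0] pp)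
  μ-*-dividing {suc zero}    pp _   = ⊥-elim (¬prime[1] pp)
  μ-*-dividing {suc (suc i)} {t} pp p∣t = μ-square (i , i<pt , ℕ.*-monoʳ-∣ (suc (suc i)) p∣t)
    where
    i<pt : i < suc (suc i) ℕ.* t
    i<pt = ℕ.<-≤-trans (ℕ.<-trans (ℕ.n<1+n i) (ℕ.n<1+n (suc i))) (ℕ.m≤m*n (suc (suc i)) t)

module PrimePowerCongruence where

  open import Data.Nat.Base as ℕ using (ℕ; zero; suc; _≤_; _<_; _∸_; z≤n; s≤s; NonZero; _!)
  import Data.Nat.Properties as ℕ
  open import Data.Nat.Divisibility as ℕ using (divides)
  open import Data.Nat.DivMod using (m/n*n≡m)
  open import Data.Nat.Combinatorics using (_C_; nCk≡n!/k![n-k]!; k![n∸k]!∣n!; k>n⇒nCk≡0; nCn≡1; nCk+nC[k+1]≡[n+1]C[k+1])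
  open import Data.Nat.Primality using (Prime; euclidsLemma; prime⇒nonZero; prime⇒nonTrivial; ¬prime[0])
  open import Data.Integer.Base using (ℤ; +_; -[1+_]; _+_; _*_; -_; _-_; _^_)
  import Data.Integer.Properties as ℤ
  open import Data.Integer.Divisibility.Signed using (_∣_; ∣ᵤ⇒∣; ∣m∣n⇒∣m+n; ∣m∣n⇒∣m-n; ∣m⇒∣m*n; ∣n⇒∣m*n; ∣-trans)
  import Data.Integer.Divisibility.Signed as ℤ
  open import Data.Integer.Tactic.RingSolver using (solve-∀)
  open import Data.Sum.Base using (inj₁; inj₂; [_,_])
  open import Function.Base using (_∘_; id)
  open import Data.Empty using (⊥-elim)
  open import Relation.Nullary using (¬_)
  open import Relation.Binary.PropositionalEquality hiding ([_])
  open IntegerRing using (∑; ∑-head; ∑-cong; *-distribˡ-∑; ∑-distrib-+; ∑-∣)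
  open ≡-Reasoning

  ∣-pow-sub : ∀ {m x y} n → m ∣ x - y → m ∣ x ^ n - y ^ n
  ∣-pow-sub {m} {x} {y} zero    _     = subst (m ∣_) (sym (ℤ.+-inverseʳ (+ 1))) (ℤ.divides (+ 0) refl)
  ∣-pow-sub {m} {x} {y} (suc n) m∣x-y = subst (m ∣_) (sym (split x y (x ^ n) (y ^ n)))
    (∣m∣n⇒∣m+n (∣n⇒∣m*n x (∣-pow-sub n m∣x-y)) (∣m⇒∣m*n (y ^ n) m∣x-y))
    where
    split : ∀ x y a b → x * a - y * b ≡ x * (a - b) + (x - y) * b
    split = solve-∀

  geometric : ℕ → ℤ → ℤ → ℤ
  geometric zero    x y = + 0
  geometric (suc n) x y = x ^ n + y * geometric n x y

  pow-sub-geometric : ∀ n x y → x ^ n - y ^ n ≡ (x - y) * geometric n x y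
  pow-sub-geometric zero    x y = trans (ℤ.+-inverseʳ (+ 1)) (sym (ℤ.*-zeroʳ (x - y)))
  pow-sub-geometric (suc n) x y = begin
    x * x ^ n - y * y ^ n                          ≡⟨ split x y (x ^ n) (y ^ n) ⟩
    (x - y) * x ^ n + y * (x ^ n - y ^ n)          ≡⟨ cong (λ d → (x - y) * x ^ n + y * d) (pow-sub-geometric n x y) ⟩
    (x - y) * x ^ n + y * ((x - y) * geometric n x y) ≡⟨ merge x y (x ^ n) (geometric n x y) ⟩
    (x - y) * (x ^ n + y * geometric n x y)        ∎
    where
    split : ∀ x y a b → x * a - y * b ≡ (x - y) * a + y * (a - b)
    split = solve-∀
    merge : ∀ x y a g → (x - y) * a + y * ((x - y) * g) ≡ (x - y) * (a + y * g)
    merge = solve-∀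

  geometric-congruence : ∀ {m x y} n → m ∣ x - y → m ∣ geometric (suc n) x y - + suc n * y ^ n
  geometric-congruence {m} {x} {y} zero    _     =
    subst (m ∣_) (sym (vanish y)) (ℤ.divides (+ 0) refl)
    where
    vanish : ∀ y → + 1 + y * + 0 - + 1 * + 1 ≡ + 0
    vanish = solve-∀
  geometric-congruence {m} {x} {y} (suc n) m∣x-y =
    subst (m ∣_) (sym (regroup (x ^ suc n) y (y ^ n) (geometric (suc n) x y) (+ suc n)))
      (∣m∣n⇒∣m+n (∣-pow-sub {x = x} {y} (suc n) m∣x-y) (∣n⇒∣m*n y (geometric-congruence {x = x} {y} n m∣x-y)))
    where
    regroup : ∀ a y b g k → a + y * g - (+ 1 + k) * (y * b) ≡ (a - y * b) + y * (g - k * b)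
    regroup = solve-∀

  ∣-geometric : ∀ {x y} n .{{_ : NonZero n}} → + n ∣ x - y → + n ∣ geometric n x y
  ∣-geometric {x} {y} (suc q) n∣x-y = subst (+ suc q ∣_) (sub-add (geometric (suc q) x y) (+ suc q * y ^ q))
    (∣m∣n⇒∣m+n (geometric-congruence q n∣x-y) (∣m⇒∣m*n (y ^ q) ℤ.∣-refl))
    where
    sub-add : ∀ a b → a - b + b ≡ a
    sub-add = solve-∀

  *-pres-∣ : ∀ {a b x y} → a ∣ x → b ∣ y → a * b ∣ x * y
  *-pres-∣ {a} {b} {x} a∣x b∣y = ∣-trans (ℤ.*-monoˡ-∣ b a∣x) (ℤ.*-monoʳ-∣ x b∣y)

  binomial : ∀ n x → (+ 1 + x) ^ n ≡ ∑ (suc n) (λ k → + (n C k) * x ^ k)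
  binomial zero    x = refl
  binomial (suc n) x = begin
    (+ 1 + x) * (+ 1 + x) ^ n                               ≡⟨ cong ((+ 1 + x) *_) (trans (binomial n x) (∑-head n f)) ⟩
    (+ 1 + x) * (+ 1 + S)                                   ≡⟨ expand x S ⟩
    + 1 + (x * (+ 1 + S) + (S + + 0))                       ≡⟨ cong₂ (λ a b → + 1 + (x * a + (S + b))) (sym (∑-head n f)) top≡0 ⟩
    + 1 + (x * ∑ (suc n) f + ∑ (suc n) (λ k → f (suc k)))   ≡⟨ cong (λ a → + 1 + (a + ∑ (suc n) (λ k → f (suc k)))) (*-distribˡ-∑ (suc n) x f) ⟩
    + 1 + (∑ (suc n) (λ k → x * f k) + ∑ (suc n) (λ k → f (suc k))) ≡⟨ cong (_+_ (+ 1)) (sym (∑-distrib-+ (suc n) _ _)) ⟩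
    + 1 + ∑ (suc n) (λ k → x * f k + f (suc k))             ≡⟨ cong (_+_ (+ 1)) (∑-cong (suc n) (λ k _ → pascal k)) ⟩
    + 1 + ∑ (suc n) (λ k → + (suc n C suc k) * x ^ suc k)   ≡⟨ sym (∑-head (suc n) (λ k → + (suc n C k) * x ^ k)) ⟩
    ∑ (suc (suc n)) (λ k → + (suc n C k) * x ^ k)           ∎
    where
    f : ℕ → ℤ
    f k = + (n C k) * x ^ k
    S = ∑ n (λ k → f (suc k))
    expand : ∀ x s → (+ 1 + x) * (+ 1 + s) ≡ + 1 + (x * (+ 1 + s) + (s + + 0))
    expand = solve-∀
    top≡0 : + 0 ≡ f (suc n)
    top≡0 = sym (trans (cong (λ c → + c * x ^ suc n) (k>n⇒nCk≡0 (ℕ.n<1+n n))) (ℤ.*-zeroˡ (x ^ suc n)))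
    pascal : ∀ k → x * f k + f (suc k) ≡ + (suc n C suc k) * x ^ suc k
    pascal k = begin
      x * (+ (n C k) * x ^ k) + + (n C suc k) * (x * x ^ k)   ≡⟨ collect x (+ (n C k)) (+ (n C suc k)) (x ^ k) ⟩
      (+ (n C k) + + (n C suc k)) * (x * x ^ k)               ≡⟨ cong (_* (x * x ^ k)) (trans (sym (ℤ.pos-+ (n C k) _))
                                                                   (cong +_ (nCk+nC[k+1]≡[n+1]C[k+1] n k))) ⟩
      + (suc n C suc k) * x ^ suc k                           ∎
      where
      collect : ∀ x a b y → x * (a * y) + b * (x * y) ≡ (a + b) * (x * y)
      collect = solve-∀

  prime∤! : ∀ {p n} → Prime p → n < p → ¬ p ℕ.∣ n !
  prime∤! {p} {zero}  pp _   p∣1 = ℕ.<⇒≱ (ℕ.nonTrivial⇒n>1 p ⦃ prime⇒nonTrivial pp ⦄) (ℕ.∣⇒≤ p∣1)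
  prime∤! {p} {suc n} pp n<p p∣n! with euclidsLemma (suc n) (n !) pp p∣n!
  ... | inj₁ p∣1+n = ℕ.<⇒≱ n<p (ℕ.∣⇒≤ p∣1+n)
  ... | inj₂ p∣n!  = prime∤! pp (ℕ.<-trans (ℕ.n<1+n n) n<p) p∣n!

  n∣n! : ∀ n .{{_ : NonZero n}} → n ℕ.∣ n !
  n∣n! (suc n) = ℕ.m∣m*n (n !)

  prime∣C : ∀ {p k} → Prime p → 0 < k → k < p → p ℕ.∣ p C k
  prime∣C {p} {k} pp 0<k k<p =
    [ id , ⊥-elim ∘ p∤k![p-k]! ] (euclidsLemma (p C k) (k ! ℕ.* (p ∸ k) !) pp p∣C*k![p-k]!)
    where
    instance
      _ = ℕ._!*_!≢0 k (p ∸ k)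
      _ = prime⇒nonZero pp
    p∣C*k![p-k]! : p ℕ.∣ (p C k) ℕ.* (k ! ℕ.* (p ∸ k) !)
    p∣C*k![p-k]! = subst (p ℕ.∣_)
      (sym (trans (cong (λ c → c ℕ.* (k ! ℕ.* (p ∸ k) !)) (nCk≡n!/k![n-k]! (ℕ.<⇒≤ k<p))) (m/n*n≡m (k![n∸k]!∣n! (ℕ.<⇒≤ k<p)))))
      (n∣n! p)
    p∤k![p-k]! : ¬ p ℕ.∣ k ! ℕ.* (p ∸ k) !
    p∤k![p-k]! p∣k![p-k]! = [ prime∤! pp k<p , prime∤! pp (ℕ.∸-monoʳ-< 0<k (ℕ.<⇒≤ k<p)) ]
                              (euclidsLemma (k !) ((p ∸ k) !) pp p∣k![p-k]!)

  freshmans-dream : ∀ {p} → Prime p → ∀ x → + p ∣ (+ 1 + x) ^ p - x ^ p - + 1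
  freshmans-dream {zero}  pp = ⊥-elim (¬prime[0] pp)
  freshmans-dream {suc q} pp x = subst (+ suc q ∣_) (sym expansion) (∑-∣ q _ middle)
    where
    f : ℕ → ℤ
    f k = + (suc q C k) * x ^ k
    M = ∑ q (λ k → f (suc k))
    middle : ∀ k → k < q → + suc q ∣ f (suc k)
    middle k k<q = ∣m⇒∣m*n (x ^ suc k) (∣ᵤ⇒∣ {+ suc q} {+ (suc q C suc k)} (prime∣C pp (s≤s z≤n) (s≤s k<q)))
    cancel : ∀ m y → + 1 * + 1 + m + + 1 * y - y - + 1 ≡ m
    cancel = solve-∀
    expansion : (+ 1 + x) ^ suc q - x ^ suc q - + 1 ≡ M
    expansion = begin
      (+ 1 + x) ^ suc q - x ^ suc q - + 1         ≡⟨ cong (λ t → t - x ^ suc q - + 1) (binomial (suc q) x) ⟩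
      ∑ (suc q) f + f (suc q) - x ^ suc q - + 1   ≡⟨ cong₂ (λ a c → a + + c * x ^ suc q - x ^ suc q - + 1) (∑-head q f) (nCn≡1 (suc q)) ⟩
      + 1 * + 1 + M + + 1 * x ^ suc q - x ^ suc q - + 1 ≡⟨ cancel M (x ^ suc q) ⟩
      M                                           ∎

  module _ {p} (pp : Prime p) (x : ℤ) where

    fermat-suc : + p ∣ x ^ p - x → + p ∣ (+ 1 + x) ^ p - (+ 1 + x)
    fermat-suc p∣x^p-x = subst (+ p ∣_) (sym (regroup ((+ 1 + x) ^ p) (x ^ p) x))
                           (∣m∣n⇒∣m+n (freshmans-dream pp x) p∣x^p-x)
      where
      regroup : ∀ a b x → a - (+ 1 + x) ≡ (a - b - + 1) + (b - x)
      regroup = solve-∀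

    fermat-pred : + p ∣ (+ 1 + x) ^ p - (+ 1 + x) → + p ∣ x ^ p - x
    fermat-pred p∣ = subst (+ p ∣_) (sym (regroup ((+ 1 + x) ^ p) (x ^ p) x))
                       (∣m∣n⇒∣m-n p∣ (freshmans-dream pp x))
      where
      regroup : ∀ a b x → b - x ≡ (a - (+ 1 + x)) - (a - b - + 1)
      regroup = solve-∀

  fermat : ∀ {p} → Prime p → ∀ x → + p ∣ x ^ p - x
  fermat {zero}  pp _              = ⊥-elim (¬prime[0] pp)
  fermat {suc q} pp (+ zero)       = ℤ.divides (+ 0) refl
  fermat {suc q} pp (+ suc n)      = fermat-suc pp (+ n) (fermat pp (+ n))
  fermat {suc q} pp -[1+ zero ]    = fermat-pred pp -[1+ zero ] (fermat pp (+ zero))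
  fermat {suc q} pp -[1+ suc n ]   = fermat-pred pp -[1+ suc n ] (fermat pp -[1+ n ])

  module _ {p} (pp : Prime p) where

    private
      instance
        p≢0 : NonZero p
        p≢0 = prime⇒nonZero pp

    ∣-pow-sub-lift : ∀ {F} x y → + (p ℕ.^ suc F) ∣ x - y → + (p ℕ.^ suc (suc F)) ∣ x ^ p - y ^ p
    ∣-pow-sub-lift {F} x y pᶠ∣x-y = subst₂ _∣_ modulus (sym (pow-sub-geometric p x y)) (*-pres-∣ pᶠ∣x-y p∣geometric)
      where
      modulus : + (p ℕ.^ suc F) * + p ≡ + (p ℕ.^ suc (suc F))
      modulus = trans (sym (ℤ.pos-* (p ℕ.^ suc F) p)) (cong +_ (ℕ.*-comm (p ℕ.^ suc F) p))
      p∣x-y : + p ∣ x - y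
      p∣x-y = ∣-trans (∣ᵤ⇒∣ (ℕ.m∣m*n (p ℕ.^ F))) pᶠ∣x-y
      p∣geometric : + p ∣ geometric p x y
      p∣geometric = ∣-geometric p p∣x-y


    prime-power-congruence : ∀ E a → + (p ℕ.^ suc E) ∣ a ^ (p ℕ.^ suc E) - a ^ (p ℕ.^ E)
    prime-power-congruence zero    a = subst₂ (λ m b → + m ∣ a ^ m - b) (sym (ℕ.*-identityʳ p)) (sym (ℤ.*-identityʳ a))
                                         (fermat pp a)
    prime-power-congruence (suc E) a = subst₂ (λ u v → + (p ℕ.^ suc (suc E)) ∣ u - v) (pow-pow (p ℕ.^ suc E)) (pow-pow (p ℕ.^ E))
                                         (∣-pow-sub-lift {E} (a ^ (p ℕ.^ suc E)) (a ^ (p ℕ.^ E)) (prime-power-congruence E a))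
      where
      pow-pow : ∀ m → (a ^ m) ^ p ≡ a ^ (p ℕ.* m)
      pow-pow m = trans (ℤ.^-*-assoc a m p) (cong (a ^_) (ℕ.*-comm m p))

module PowersDold where

  open import Data.Nat.Base as ℕ using (ℕ; zero; suc; _≤_; _<_; z≤n; s≤s; NonZero; _^_)
  import Data.Nat.Properties as ℕ
  open import Data.Nat.DivMod using (_/_; *-/-assoc; m*n/o*n≡m/o; m*[n/m]≡n)
  open import Data.Nat.Divisibility as ℕ using (_∣_; _∣?_; divides; ∣-refl; ∣-trans; ∣1⇒≡1)
  open import Data.Nat.Coprimality as Coprime using (Coprime; coprime-divisor)
  open import Data.Nat.Primality using (Prime; prime?; prime⇒irreducible; prime⇒nonZero; prime⇒nonTrivial; ¬prime⇒composite)
  open import Data.Nat.Divisibility.Core using (hasNonTrivialDivisor)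
  open import Data.Nat.Induction using (<-rec)
  open import Algebra.Properties.CommutativeSemigroup ℕ.*-commutativeSemigroup using (x∙yz≈y∙xz)
  open import Induction.WellFounded using (WfRec)
  open import Data.Integer.Base as ℤ using (ℤ; +_; -_; _-_)
  import Data.Integer.Properties as ℤ
  import Data.Integer.Divisibility.Signed as ℤ
  open import Data.Integer.Tactic.RingSolver using (solve-∀)
  open import Data.Sum.Base using (inj₁; inj₂)
  open import Data.Product.Base using (Σ; _×_; _,_)
  open import Data.Empty using (⊥-elim)
  open import Relation.Nullary using (¬_; yes; no)
  open import Relation.Binary.PropositionalEquality

  prime-coprime : ∀ {p d} → Prime p → ¬ p ∣ d → Coprime p d
  prime-coprime pp p∤d (i∣p , i∣d) with prime⇒irreducible pp i∣p
  ... | inj₁ i≡1  = i≡1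
  ... | inj₂ refl = ⊥-elim (p∤d i∣d)

  prime-power-coprime : ∀ {p d} → Prime p → ¬ p ∣ d → ∀ E → Coprime (p ^ E) d
  prime-power-coprime pp p∤d zero    (i∣1 , _) = ∣1⇒≡1 i∣1
  prime-power-coprime {p} pp p∤d (suc E) {i} (i∣pᴱ⁺¹ , i∣d) =
    prime-power-coprime pp p∤d E (coprime-divisor i⊥p i∣pᴱ⁺¹ , i∣d)
    where
    i⊥p : Coprime i p
    i⊥p (j∣i , j∣p) = prime-coprime pp p∤d (j∣p , ∣-trans j∣i i∣d)

  open Möbius using (μ-*-dividing; μ-*-coprime)
  open DivisorSum
  open DoldSums
  open PrimePowerCongruence using (prime-power-congruence)

  möbiusTerm-nonZero : ∀ A n d .{{_ : NonZero d}} → möbiusTerm A n d ≡ μ d ℤ.* A (n / d)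
  möbiusTerm-nonZero A n (suc k) = refl

  module _ {p} (pp : Prime p) where

    private
      instance
        p≢0 : NonZero p
        p≢0 = prime⇒nonZero pp

    möbiusTerm-multiple : ∀ A M t .{{_ : NonZero t}} →
                          möbiusTerm A (M ℕ.* p) (t ℕ.* p) ≡ - primeTo p (möbiusTerm A M) t
    möbiusTerm-multiple A M t = trans unfold signed
      where
      instance
        tp≢0 : NonZero (t ℕ.* p)
        tp≢0 = ℕ.m*n≢0 t p
      unfold : möbiusTerm A (M ℕ.* p) (t ℕ.* p) ≡ μ (p ℕ.* t) ℤ.* A (M / t)
      unfold = trans (möbiusTerm-nonZero A (M ℕ.* p) (t ℕ.* p))
                     (cong₂ (λ d n → μ d ℤ.* A n) (ℕ.*-comm t p) (m*n/o*n≡m/o M p t))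
      signed : μ (p ℕ.* t) ℤ.* A (M / t) ≡ - primeTo p (möbiusTerm A M) t
      signed with p ∣? t
      ... | yes p∣t = trans (cong (ℤ._* A (M / t)) (μ-*-dividing pp p∣t)) (ℤ.*-zeroˡ (A (M / t)))
      ... | no  p∤t = begin
        μ (p ℕ.* t) ℤ.* A (M / t)     ≡⟨ cong (ℤ._* A (M / t)) (μ-*-coprime pp p∤t) ⟩
        - μ t ℤ.* A (M / t)           ≡⟨ ℤ.neg-distribˡ-* (μ t) (A (M / t)) ⟨
        - (μ t ℤ.* A (M / t))         ≡⟨ cong -_ (möbiusTerm-nonZero A M t) ⟨
        - möbiusTerm A M t            ∎
        where open ≡-Reasoning

    -- the divisors t·p of M·p contribute μ(t p) A(M / t), which is - μ(t) A(M / t) or 0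
    doldSum-primeTo : ∀ A M .{{_ : NonZero M}} →
      doldSum A (M ℕ.* p) ≡ divisorSum (M ℕ.* p) (λ d → primeTo p (möbiusTerm A (M ℕ.* p)) d - primeTo p (möbiusTerm A M) d)
    doldSum-primeTo A M = begin
      doldSum A N                                                      ≡⟨ doldSum≡divisorSum A N ⟩
      divisorSum N (möbiusTerm A N)                                    ≡⟨ divisorSum-splitBy p M (möbiusTerm A N) ⟩
      divisorSum N (primeTo p (möbiusTerm A N)) ℤ.+ divisorSum M (λ t → möbiusTerm A N (t ℕ.* p))
        ≡⟨ cong (ℤ._+_ (divisorSum N (primeTo p (möbiusTerm A N))))
                (trans (divisorSum-cong M {λ t → möbiusTerm A N (t ℕ.* p)} {λ t → - primeTo p (möbiusTerm A M) t}
                                        (λ k _ → möbiusTerm-multiple A M (suc k)))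
                       (divisorSum-neg M (primeTo p (möbiusTerm A M)))) ⟩
      divisorSum N (primeTo p (möbiusTerm A N)) - divisorSum M (primeTo p (möbiusTerm A M))
        ≡⟨ cong (λ x → divisorSum N (primeTo p (möbiusTerm A N)) - x)
                (sym (divisorSum-restrict (primeTo p (möbiusTerm A M)) (ℕ.m∣m*n p) outside)) ⟩
      divisorSum N (primeTo p (möbiusTerm A N)) - divisorSum N (primeTo p (möbiusTerm A M))
        ≡⟨ divisorSum-sub N (primeTo p (möbiusTerm A N)) (primeTo p (möbiusTerm A M)) ⟨
      divisorSum N (λ d → primeTo p (möbiusTerm A N) d - primeTo p (möbiusTerm A M) d) ∎
      where
      open ≡-Reasoning
      N = M ℕ.* p
      instance
        N≢0 : NonZero N
        N≢0 = ℕ.m*n≢0 M p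
      outside : ∀ k → suc k ∣ N → ¬ suc k ∣ M → primeTo p (möbiusTerm A M) (suc k) ≡ + 0
      outside k d∣N d∤M with p ∣? suc k
      ... | yes _   = refl
      ... | no  p∤d = ⊥-elim (d∤M (coprime-divisor (Coprime.sym (prime-coprime pp p∤d))
                                                   (subst (suc k ∣_) (ℕ.*-comm M p) d∣N)))

    power-congruence-at-divisor : ∀ c E m′ d .{{_ : NonZero d}} → ¬ p ∣ d → d ∣ p ^ E ℕ.* m′ →
      + (p ^ suc E) ℤ.∣ c ℤ.^ (p ^ E ℕ.* m′ ℕ.* p / d) - c ℤ.^ (p ^ E ℕ.* m′ / d)
    power-congruence-at-divisor c E m′ d p∤d d∣M =
      congruence (coprime-divisor (prime-power-coprime pp p∤d E) pᴱ∣d*[M/d])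
      where
      M = p ^ E ℕ.* m′
      pᴱ∣d*[M/d] : p ^ E ∣ d ℕ.* (M / d)
      pᴱ∣d*[M/d] = subst (p ^ E ∣_) (sym (m*[n/m]≡n d∣M)) (ℕ.m∣m*n m′)
      congruence : p ^ E ∣ M / d → + (p ^ suc E) ℤ.∣ c ℤ.^ (M ℕ.* p / d) - c ℤ.^ (M / d)
      congruence (divides s M/d≡s*pᴱ) =
        subst₂ (λ x y → + (p ^ suc E) ℤ.∣ c ℤ.^ x - c ℤ.^ y) (sym Mp/d≡) (sym M/d≡s*pᴱ)
          (subst₂ (λ x y → + (p ^ suc E) ℤ.∣ x - y) (ℤ.^-*-assoc c s (p ^ suc E)) (ℤ.^-*-assoc c s (p ^ E))
            (prime-power-congruence pp E (c ℤ.^ s)))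
        where
        Mp/d≡ : M ℕ.* p / d ≡ s ℕ.* p ^ suc E
        Mp/d≡ = begin
          M ℕ.* p / d          ≡⟨ cong (_/ d) (ℕ.*-comm M p) ⟩
          p ℕ.* M / d          ≡⟨ *-/-assoc p d∣M ⟩
          p ℕ.* (M / d)        ≡⟨ cong (p ℕ.*_) M/d≡s*pᴱ ⟩
          p ℕ.* (s ℕ.* p ^ E)  ≡⟨ x∙yz≈y∙xz p s (p ^ E) ⟩
          s ℕ.* (p ℕ.* p ^ E)  ∎
          where open ≡-Reasoning

    prime-power-∣-doldSum : ∀ c E m′ → .{{_ : NonZero m′}} → + (p ^ suc E) ℤ.∣ doldSum (c ℤ.^_) (p ^ suc E ℕ.* m′)
    prime-power-∣-doldSum c E m′ = subst (λ n → + (p ^ suc E) ℤ.∣ doldSum (c ℤ.^_) n) (sym N≡)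
      (subst (+ (p ^ suc E) ℤ.∣_) (sym (doldSum-primeTo (c ℤ.^_) M))
        (divisorSum-∣ (M ℕ.* p) difference termwise))
      where
      M = p ^ E ℕ.* m′
      instance
        M≢0 : NonZero M
        M≢0 = ℕ.m*n≢0 (p ^ E) m′ ⦃ ℕ.m^n≢0 p E ⦄
      difference : ℕ → ℤ
      difference d = primeTo p (möbiusTerm (c ℤ.^_) (M ℕ.* p)) d - primeTo p (möbiusTerm (c ℤ.^_) M) d
      N≡ : p ^ suc E ℕ.* m′ ≡ M ℕ.* p
      N≡ = trans (ℕ.*-assoc p (p ^ E) m′) (ℕ.*-comm p M)
      termwise : ∀ k → suc k ∣ M ℕ.* p → + (p ^ suc E) ℤ.∣ difference (suc k)
      termwise k d∣N with p ∣? suc k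
      ... | yes _   = ℤ.divides (+ 0) refl
      ... | no  p∤d = subst (+ (p ^ suc E) ℤ.∣_) (sym (factor (μ (suc k)) _ _))
                        (ℤ.∣n⇒∣m*n (μ (suc k)) (power-congruence-at-divisor c E m′ (suc k) p∤d d∣M))
        where
        d∣M : suc k ∣ M
        d∣M = coprime-divisor (Coprime.sym (prime-coprime pp p∤d)) (subst (suc k ∣_) (ℕ.*-comm M p) d∣N)
        factor : ∀ m x y → m ℤ.* x - m ℤ.* y ≡ m ℤ.* (x - y)
        factor = solve-∀

  prime-factor : ∀ m → 2 ≤ m → Σ ℕ λ p → Prime p × p ∣ m
  prime-factor = <-rec _ step
    where
    step : ∀ m → WfRec _<_ (λ m → 2 ≤ m → Σ ℕ λ p → Prime p × p ∣ m) m → 2 ≤ m → Σ ℕ λ p → Prime p × p ∣ m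
    step m IH 2≤m with prime? m
    ... | yes pm = m , pm , ∣-refl
    ... | no ¬pm with ¬prime⇒composite ⦃ ℕ.n>1⇒nonTrivial 2≤m ⦄ ¬pm
    ...   | hasNonTrivialDivisor d<m d∣m with IH d<m (ℕ.nonTrivial⇒n>1 _)
    ...     | p , pp , p∣d = p , pp , ∣-trans p∣d d∣m

  split-prime-power : ∀ {p} → Prime p → ∀ m → .{{NonZero m}} → Σ ℕ λ E → Σ ℕ λ m′ → m ≡ p ^ E ℕ.* m′ × ¬ p ∣ m′
  split-prime-power {p} pp = <-rec _ step
    where
    Split : ℕ → Set
    Split m = .{{NonZero m}} → Σ ℕ λ E → Σ ℕ λ m′ → m ≡ p ^ E ℕ.* m′ × ¬ p ∣ m′
    step : ∀ m → WfRec _<_ Split m → Split m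
    step m IH with p ∣? m
    ... | no  p∤m = 0 , m , sym (ℕ.+-identityʳ m) , p∤m
    ... | yes (divides k@(suc _) refl) with IH (ℕ.m<m*n k p (ℕ.nonTrivial⇒n>1 p ⦃ prime⇒nonTrivial pp ⦄))
    ...   | E , m′ , k≡pᴱm′ , p∤m′ = suc E , m′ , k*p≡ , p∤m′
      where
      k*p≡ : k ℕ.* p ≡ p ^ suc E ℕ.* m′
      k*p≡ = trans (cong (ℕ._* p) k≡pᴱm′) (trans (ℕ.*-comm (p ^ E ℕ.* m′) p) (sym (ℕ.*-assoc p (p ^ E) m′)))

  ∣-from-prime-powers : ∀ X m → .{{NonZero m}} → (∀ p E m′ → Prime p → m ≡ p ^ E ℕ.* m′ → p ^ E ∣ X) → m ∣ X
  ∣-from-prime-powers X = <-rec _ step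
    where
    Local : ℕ → Set
    Local m = .{{NonZero m}} → (∀ p E m′ → Prime p → m ≡ p ^ E ℕ.* m′ → p ^ E ∣ X) → m ∣ X
    step : ∀ m → WfRec _<_ Local m → Local m
    step 1             _  _     = ℕ.1∣ X
    step m@(suc (suc _)) IH local with prime-factor m (s≤s (s≤s z≤n))
    ... | p , pp , p∣m with split-prime-power pp m
    ...   | zero  , m′ , m≡m′ , p∤m′ = ⊥-elim (p∤m′ (subst (p ∣_) (trans m≡m′ (ℕ.*-identityˡ m′)) p∣m))
    ...   | suc E , m′ , m≡pᴱm′ , p∤m′ = subst (_∣ X) (sym m≡pᴱm′) pᴱm′∣X
      where
      instance
        m′≢0 : NonZero m′
        m′≢0 = ℕ.m*n≢0⇒n≢0 (p ^ suc E) ⦃ subst NonZero m≡pᴱm′ _ ⦄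
        pᴱ≢0 : NonZero (p ^ E)
        pᴱ≢0 = ℕ.m^n≢0 p E ⦃ prime⇒nonZero pp ⦄
      1<pᴱ⁺¹ : 1 < p ^ suc E
      1<pᴱ⁺¹ = ℕ.<-≤-trans (ℕ.nonTrivial⇒n>1 p ⦃ prime⇒nonTrivial pp ⦄) (ℕ.m≤m*n p (p ^ E))
      m′<m : m′ < m
      m′<m = subst (m′ <_) (trans (ℕ.*-comm m′ (p ^ suc E)) (sym m≡pᴱm′)) (ℕ.m<m*n m′ (p ^ suc E) 1<pᴱ⁺¹)
      m′∣X : m′ ∣ X
      m′∣X = IH m′<m (λ q F m″ pq m′≡ → local q F (p ^ suc E ℕ.* m″) pq
                                          (trans m≡pᴱm′ (trans (cong (p ^ suc E ℕ.*_) m′≡) (x∙yz≈y∙xz (p ^ suc E) (q ^ F) m″))))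
      pᴱm′∣X : p ^ suc E ℕ.* m′ ∣ X
      pᴱm′∣X with m′∣X
      ... | divides y refl = ℕ.*-monoˡ-∣ m′ (coprime-divisor (prime-power-coprime pp p∤m′ (suc E))
                                                             (subst (p ^ suc E ∣_) (ℕ.*-comm y m′) (local p (suc E) m′ pp m≡pᴱm′)))

  powers-dold : ∀ c → DoldCondition (c ℤ.^_)
  powers-dold c n@(suc _) _ = ∣-from-prime-powers ℤ.∣ doldSum (c ℤ.^_) n ∣ n local
    where
    local : ∀ p E m′ → Prime p → n ≡ p ^ E ℕ.* m′ → p ^ E ∣ ℤ.∣ doldSum (c ℤ.^_) n ∣
    local p zero    m′ pp _    = ℕ.1∣ _
    local p (suc E) m′ pp n≡   = ℤ.∣⇒∣ᵤ (subst (λ k → + (p ^ suc E) ℤ.∣ doldSum (c ℤ.^_) k) (sym n≡)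
                                   (prime-power-∣-doldSum pp c E m′ ⦃ ℕ.m*n≢0⇒n≢0 (p ^ suc E) ⦃ subst NonZero n≡ _ ⦄ ⦄))

module CoefficientList {c ℓ : Level} (R : CommutativeRing c ℓ) where

  open CommutativeRing R hiding (zero)
  open OverRing R using (fromℕ) renaming (ΣK to ∑)
  open FiniteSum R using (∑-cong; ∑-single)
  open IntegerEmbedding R using (module ℤ-Solver)
  open ℤ-Solver using (solve; _:=_; _:+_; _:*_; _:-_; :-_; con)
  open import Algebra.Properties.Ring ring using (-0#≈0#)
  open import Algebra.Properties.Group +-group using (x∙y⁻¹≈ε⇒x≈y)
  open import Data.Nat.Base as ℕ using (ℕ; zero; suc; _≤_; _<_; z≤n; s≤s)
  open import Relation.Nullary using (¬_)
  import Data.Nat.Properties as ℕ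
  open import Data.Integer.Base using (+_)
  open import Data.List.Base using (List; []; _∷_; length; drop)
  open import Relation.Binary.PropositionalEquality as ≡ using (_≡_)
  open import Relation.Binary.Reasoning.Setoid setoid

  evalPoly : List Carrier → Carrier → Carrier
  evalPoly []       x = 0#
  evalPoly (a ∷ as) x = a + x * evalPoly as x

  coeff : List Carrier → ℕ → Carrier
  coeff []       k       = 0#
  coeff (a ∷ as) zero    = a
  coeff (a ∷ as) (suc k) = coeff as k

  -- the quotient of L(x) - L(γ) by x - γ (synthetic division)
  divideRoot : Carrier → List Carrier → List Carrier
  divideRoot γ []           = []
  divideRoot γ (a ∷ [])     = []
  divideRoot γ (a ∷ b ∷ bs) = evalPoly (b ∷ bs) γ ∷ divideRoot γ (b ∷ bs)

  length-divideRoot : ∀ γ L → length (divideRoot γ L) ≡ ℕ.pred (length L)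
  length-divideRoot γ []           = ≡.refl
  length-divideRoot γ (a ∷ [])     = ≡.refl
  length-divideRoot γ (a ∷ b ∷ bs) = ≡.cong suc (length-divideRoot γ (b ∷ bs))

  evalPoly-divideRoot : ∀ γ L x → evalPoly L x ≈ evalPoly L γ + (x - γ) * evalPoly (divideRoot γ L) x
  evalPoly-divideRoot γ []           x = solve 2 (λ x γ → con (+ 0) := con (+ 0) :+ (x :- γ) :* con (+ 0)) refl x γ
  evalPoly-divideRoot γ (a ∷ [])     x =
    solve 3 (λ a x γ → a :+ x :* con (+ 0) := (a :+ γ :* con (+ 0)) :+ (x :- γ) :* con (+ 0)) refl a x γ
  evalPoly-divideRoot γ (a ∷ b ∷ bs) x = begin
    a + x * evalPoly (b ∷ bs) x               ≈⟨ +-congˡ (*-congˡ (evalPoly-divideRoot γ (b ∷ bs) x)) ⟩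
    a + x * (B + (x - γ) * Q)                 ≈⟨ solve 5 (λ a x γ B Q → a :+ x :* (B :+ (x :- γ) :* Q)
                                                                    := (a :+ γ :* B) :+ (x :- γ) :* (B :+ x :* Q))
                                                         refl a x γ B Q ⟩
    (a + γ * B) + (x - γ) * (B + x * Q)       ∎
    where
    B = evalPoly (b ∷ bs) γ
    Q = evalPoly (divideRoot γ (b ∷ bs)) x

  drop-[] : ∀ k → drop k ([] {A = Carrier}) ≡ []
  drop-[] zero    = ≡.refl
  drop-[] (suc k) = ≡.refl

  coeff-divideRoot : ∀ γ L k → coeff (divideRoot γ L) k ≈ evalPoly (drop (suc k) L) γ
  coeff-divideRoot γ []           k       = refl
  coeff-divideRoot γ (a ∷ [])     k       = ≡.subst (λ l → 0# ≈ evalPoly l γ) (≡.sym (drop-[] k)) refl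
  coeff-divideRoot γ (a ∷ b ∷ bs) zero    = refl
  coeff-divideRoot γ (a ∷ b ∷ bs) (suc k) = coeff-divideRoot γ (b ∷ bs) k

  evalPoly-drop : ∀ L k x → evalPoly (drop k L) x ≈ coeff L k + x * evalPoly (drop (suc k) L) x
  evalPoly-drop []       k       x = ≡.subst (λ l → evalPoly l x ≈ 0# + x * 0#) (≡.sym (drop-[] k))
                                             (solve 1 (λ x → con (+ 0) := con (+ 0) :+ x :* con (+ 0)) refl x)
  evalPoly-drop (a ∷ as) zero    x = refl
  evalPoly-drop (a ∷ as) (suc k) x = evalPoly-drop as k x

  addPoly : List Carrier → List Carrier → List Carrier
  addPoly []       q        = q
  addPoly (a ∷ p)  []       = a ∷ p
  addPoly (a ∷ p)  (b ∷ q)  = (a + b) ∷ addPoly p q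

  evalPoly-addPoly : ∀ p q x → evalPoly (addPoly p q) x ≈ evalPoly p x + evalPoly q x
  evalPoly-addPoly []      q       x = sym (+-identityˡ _)
  evalPoly-addPoly (a ∷ p) []      x = sym (+-identityʳ _)
  evalPoly-addPoly (a ∷ p) (b ∷ q) x = trans (+-congˡ (*-congˡ (evalPoly-addPoly p q x)))
    (solve 5 (λ a b x P Q → (a :+ b) :+ x :* (P :+ Q) := (a :+ x :* P) :+ (b :+ x :* Q)) refl a b x (evalPoly p x) (evalPoly q x))

  coeff-addPoly : ∀ p q k → coeff (addPoly p q) k ≈ coeff p k + coeff q k
  coeff-addPoly []      q       k       = sym (+-identityˡ _)
  coeff-addPoly (a ∷ p) []      k       = sym (+-identityʳ _)
  coeff-addPoly (a ∷ p) (b ∷ q) zero    = refl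
  coeff-addPoly (a ∷ p) (b ∷ q) (suc k) = coeff-addPoly p q k

  length-addPoly : ∀ p q {n} → length p ≤ n → length q ≤ n → length (addPoly p q) ≤ n
  length-addPoly []      q       _       |q|≤n = |q|≤n
  length-addPoly (a ∷ p) []      |p|≤n   _     = |p|≤n
  length-addPoly (a ∷ p) (b ∷ q) (s≤s |p|≤n) (s≤s |q|≤n) = s≤s (length-addPoly p q |p|≤n |q|≤n)

  negPoly : List Carrier → List Carrier
  negPoly []      = []
  negPoly (a ∷ p) = - a ∷ negPoly p

  evalPoly-negPoly : ∀ p x → evalPoly (negPoly p) x ≈ - evalPoly p x
  evalPoly-negPoly []      x = sym -0#≈0#
  evalPoly-negPoly (a ∷ p) x = trans (+-congˡ (*-congˡ (evalPoly-negPoly p x)))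
    (solve 3 (λ a x P → :- a :+ x :* (:- P) := :- (a :+ x :* P)) refl a x (evalPoly p x))

  coeff-negPoly : ∀ p k → coeff (negPoly p) k ≈ - coeff p k
  coeff-negPoly []      k       = sym -0#≈0#
  coeff-negPoly (a ∷ p) zero    = refl
  coeff-negPoly (a ∷ p) (suc k) = coeff-negPoly p k

  length-negPoly : ∀ p → length (negPoly p) ≡ length p
  length-negPoly []      = ≡.refl
  length-negPoly (a ∷ p) = ≡.cong suc (length-negPoly p)

  derivative : List Carrier → List Carrier
  derivative []           = []
  derivative (a ∷ [])     = []
  derivative (a ∷ b ∷ bs) = addPoly (b ∷ bs) (0# ∷ derivative (b ∷ bs))

  length-derivative : ∀ L → length (derivative L) ≤ ℕ.pred (length L)
  length-derivative []           = z≤n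
  length-derivative (a ∷ [])     = z≤n
  length-derivative (a ∷ b ∷ bs) =
    length-addPoly (b ∷ bs) (0# ∷ derivative (b ∷ bs)) ℕ.≤-refl (s≤s (length-derivative (b ∷ bs)))

  coeff-derivative : ∀ L k → coeff (derivative L) k ≈ fromℕ (suc k) * coeff L (suc k)
  coeff-derivative []           k       = sym (zeroʳ _)
  coeff-derivative (a ∷ [])     k       = sym (zeroʳ _)
  coeff-derivative (a ∷ b ∷ bs) zero    = trans (coeff-addPoly (b ∷ bs) (0# ∷ derivative (b ∷ bs)) zero)
    (solve 1 (λ b → b :+ con (+ 0) := con (+ 1) :* b) refl b)
  coeff-derivative (a ∷ b ∷ bs) (suc k) = begin
    coeff (addPoly (b ∷ bs) (0# ∷ derivative (b ∷ bs))) (suc k)  ≈⟨ coeff-addPoly (b ∷ bs) (0# ∷ derivative (b ∷ bs)) (suc k) ⟩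
    coeff bs k + coeff (derivative (b ∷ bs)) k                  ≈⟨ +-congˡ (coeff-derivative (b ∷ bs) k) ⟩
    coeff bs k + fromℕ (suc k) * coeff bs k                     ≈⟨ +-congʳ (sym (*-identityˡ _)) ⟩
    1# * coeff bs k + fromℕ (suc k) * coeff bs k                ≈⟨ sym (distribʳ _ _ _) ⟩
    fromℕ (suc (suc k)) * coeff bs k                            ∎

  divideRoot-at-root : ∀ γ L → evalPoly (divideRoot γ L) γ ≈ evalPoly (derivative L) γ
  divideRoot-at-root γ []           = refl
  divideRoot-at-root γ (a ∷ [])     = refl
  divideRoot-at-root γ (a ∷ b ∷ bs) = begin
    evalPoly (b ∷ bs) γ + γ * evalPoly (divideRoot γ (b ∷ bs)) γ     ≈⟨ +-congˡ (*-congˡ (divideRoot-at-root γ (b ∷ bs))) ⟩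
    evalPoly (b ∷ bs) γ + γ * evalPoly (derivative (b ∷ bs)) γ       ≈⟨ +-congˡ (sym (+-identityˡ _)) ⟩
    evalPoly (b ∷ bs) γ + (0# + γ * evalPoly (derivative (b ∷ bs)) γ) ≈⟨ sym (evalPoly-addPoly (b ∷ bs) (0# ∷ derivative (b ∷ bs)) γ) ⟩
    evalPoly (derivative (a ∷ b ∷ bs)) γ                            ∎

  quotientSum : (ℕ → Carrier) → List Carrier → ℕ → List Carrier
  quotientSum γ L zero    = []
  quotientSum γ L (suc m) = addPoly (quotientSum γ L m) (divideRoot (γ m) L)

  evalPoly-quotientSum : ∀ γ L m x → evalPoly (quotientSum γ L m) x ≈ ∑ m (λ i → evalPoly (divideRoot (γ i) L) x)
  evalPoly-quotientSum γ L zero    x = refl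
  evalPoly-quotientSum γ L (suc m) x = trans (evalPoly-addPoly (quotientSum γ L m) _ x) (+-congʳ (evalPoly-quotientSum γ L m x))

  coeff-quotientSum : ∀ γ L m k → coeff (quotientSum γ L m) k ≈ ∑ m (λ i → coeff (divideRoot (γ i) L) k)
  coeff-quotientSum γ L zero    k = refl
  coeff-quotientSum γ L (suc m) k = trans (coeff-addPoly (quotientSum γ L m) _ k) (+-congʳ (coeff-quotientSum γ L m k))

  length-quotientSum : ∀ γ L {n} m → length L ≤ suc n → length (quotientSum γ L m) ≤ n
  length-quotientSum γ L zero    _        = z≤n
  length-quotientSum γ L (suc m) |L|≤1+n = length-addPoly (quotientSum γ L m) (divideRoot (γ m) L)
    (length-quotientSum γ L m |L|≤1+n) (≡.subst (_≤ _) (≡.sym (length-divideRoot (γ m) L)) (ℕ.pred-mono-≤ |L|≤1+n))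

  module _ (cancel : ∀ {a b} → ¬ a ≈ 0# → a * b ≈ 0# → b ≈ 0#) where

    divideRoot-root : ∀ L {γ x} → ¬ x ≈ γ → evalPoly L x ≈ 0# → evalPoly L γ ≈ 0# → evalPoly (divideRoot γ L) x ≈ 0#
    divideRoot-root L {γ} {x} x≉γ Lx≈0 Lγ≈0 = cancel x-γ≉0 (begin
      (x - γ) * evalPoly (divideRoot γ L) x                 ≈⟨ sym (+-identityˡ _) ⟩
      0# + (x - γ) * evalPoly (divideRoot γ L) x            ≈⟨ +-congʳ (sym Lγ≈0) ⟩
      evalPoly L γ + (x - γ) * evalPoly (divideRoot γ L) x  ≈⟨ sym (evalPoly-divideRoot γ L x) ⟩
      evalPoly L x                                          ≈⟨ Lx≈0 ⟩
      0#                                                    ∎)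
      where
      x-γ≉0 : ¬ x - γ ≈ 0#
      x-γ≉0 x-γ≈0 = x≉γ (x∙y⁻¹≈ε⇒x≈y x γ x-γ≈0)

    vanishing-coeff : ∀ n (γ : ℕ → Carrier) L → length L ≤ n → (∀ i j → i < n → j < n → γ i ≈ γ j → i ≡ j) →
                      (∀ i → i < n → evalPoly L (γ i) ≈ 0#) → ∀ k → coeff L k ≈ 0#
    vanishing-coeff n       γ []       _            _        _     k = refl
    vanishing-coeff (suc n) γ (a ∷ as) (s≤s |as|≤n) distinct roots k = begin
      coeff L k                                                ≈⟨ solve 3 (λ c x e → c := (c :+ x :* e) :- x :* e) refl (coeff L k) γ₀ (evalPoly (drop (suc k) L) γ₀) ⟩
      (coeff L k + γ₀ * evalPoly (drop (suc k) L) γ₀) - γ₀ * evalPoly (drop (suc k) L) γ₀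
                                                               ≈⟨ +-cong (sym (evalPoly-drop L k γ₀)) (-‿cong (*-congˡ (tail≈0 (suc k)))) ⟩
      evalPoly (drop k L) γ₀ - γ₀ * 0#                         ≈⟨ +-congʳ (tail≈0 k) ⟩
      0# - γ₀ * 0#                                             ≈⟨ solve 1 (λ x → con (+ 0) :- x :* con (+ 0) := con (+ 0)) refl γ₀ ⟩
      0#                                                       ∎
      where
      L = a ∷ as
      γ₀ = γ 0
      Q = divideRoot γ₀ L
      Q-roots : ∀ i → i < n → evalPoly Q (γ (suc i)) ≈ 0#
      Q-roots i i<n = divideRoot-root L (λ γᵢ₊₁≈γ₀ → ℕ.1+n≢0 (distinct (suc i) 0 (s≤s i<n) (s≤s z≤n) γᵢ₊₁≈γ₀))
                        (roots (suc i) (s≤s i<n)) (roots 0 (s≤s z≤n))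
      Q≈0 : ∀ k → coeff Q k ≈ 0#
      Q≈0 = vanishing-coeff n (λ i → γ (suc i)) Q (≡.subst (_≤ n) (≡.sym (length-divideRoot γ₀ L)) |as|≤n)
              (λ i j i<n j<n γ≈ → ℕ.suc-injective (distinct (suc i) (suc j) (s≤s i<n) (s≤s j<n) γ≈)) Q-roots
      tail≈0 : ∀ k → evalPoly (drop k L) γ₀ ≈ 0#
      tail≈0 zero    = roots 0 (s≤s z≤n)
      tail≈0 (suc k) = trans (sym (coeff-divideRoot γ₀ L k)) (Q≈0 k)

    quotientSum≈derivative : ∀ n (γ : ℕ → Carrier) L → length L ≤ suc n →
      (∀ i j → i < n → j < n → γ i ≈ γ j → i ≡ j) → (∀ i → i < n → evalPoly L (γ i) ≈ 0#) →
      ∀ k → coeff (quotientSum γ L n) k ≈ coeff (derivative L) k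
    quotientSum≈derivative n γ L |L|≤1+n distinct roots k = x∙y⁻¹≈ε⇒x≈y _ _ (begin
      coeff (quotientSum γ L n) k - coeff (derivative L) k           ≈⟨ +-congˡ (sym (coeff-negPoly (derivative L) k)) ⟩
      coeff (quotientSum γ L n) k + coeff (negPoly (derivative L)) k ≈⟨ sym (coeff-addPoly (quotientSum γ L n) _ k) ⟩
      coeff difference k                                             ≈⟨ vanishing-coeff n γ difference length-difference distinct difference-root k ⟩
      0#                                                             ∎)
      where
      difference = addPoly (quotientSum γ L n) (negPoly (derivative L))
      length-difference : length difference ≤ n
      length-difference = length-addPoly (quotientSum γ L n) (negPoly (derivative L)) (length-quotientSum γ L n |L|≤1+n)
        (≡.subst (_≤ n) (≡.sym (length-negPoly (derivative L))) (ℕ.≤-trans (length-derivative L) (ℕ.pred-mono-≤ |L|≤1+n)))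
      difference-root : ∀ j → j < n → evalPoly difference (γ j) ≈ 0#
      difference-root j j<n = begin
        evalPoly difference (γ j)                                          ≈⟨ evalPoly-addPoly (quotientSum γ L n) _ (γ j) ⟩
        evalPoly (quotientSum γ L n) (γ j) + evalPoly (negPoly (derivative L)) (γ j)
                                                                           ≈⟨ +-cong (evalPoly-quotientSum γ L n (γ j)) (evalPoly-negPoly (derivative L) (γ j)) ⟩
        ∑ n (λ i → evalPoly (divideRoot (γ i) L) (γ j)) - evalPoly (derivative L) (γ j)
                                                                           ≈⟨ +-congʳ (∑-single n j _ j<n others) ⟩
        evalPoly (divideRoot (γ j) L) (γ j) - evalPoly (derivative L) (γ j) ≈⟨ +-congʳ (divideRoot-at-root (γ j) L) ⟩
        evalPoly (derivative L) (γ j) - evalPoly (derivative L) (γ j)      ≈⟨ -‿inverseʳ _ ⟩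
        0#                                                                 ∎
        where
        others : ∀ i → i < n → ¬ i ≡ j → evalPoly (divideRoot (γ i) L) (γ j) ≈ 0#
        others i i<n i≢j = divideRoot-root L (λ γⱼ≈γᵢ → i≢j (≡.sym (distinct j i j<n i<n γⱼ≈γᵢ))) (roots j j<n) (roots i i<n)

    -- ∑ᵢ L(x) / (x - γᵢ) = L′(x) for the n distinct roots γᵢ of L, read off at the coefficient of xᵏ
    ∑-divideRoot≈derivative : ∀ n (γ : ℕ → Carrier) L → length L ≤ suc n →
      (∀ i j → i < n → j < n → γ i ≈ γ j → i ≡ j) → (∀ i → i < n → evalPoly L (γ i) ≈ 0#) →
      ∀ k → ∑ n (λ i → evalPoly (drop (suc k) L) (γ i)) ≈ fromℕ (suc k) * coeff L (suc k)
    ∑-divideRoot≈derivative n γ L |L|≤1+n distinct roots k = begin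
      ∑ n (λ i → evalPoly (drop (suc k) L) (γ i))   ≈⟨ ∑-cong n (λ i _ → sym (coeff-divideRoot (γ i) L k)) ⟩
      ∑ n (λ i → coeff (divideRoot (γ i) L) k)      ≈⟨ sym (coeff-quotientSum γ L n k) ⟩
      coeff (quotientSum γ L n) k                   ≈⟨ quotientSum≈derivative n γ L |L|≤1+n distinct roots k ⟩
      coeff (derivative L) k                        ≈⟨ coeff-derivative L k ⟩
      fromℕ (suc k) * coeff L (suc k)               ∎

module NewtonIdentities {c ℓ : Level} (K : CommutativeRing c ℓ) where

  open CommutativeRing K hiding (zero)
  open OverRing K using (fromℕ; pow) renaming (ΣK to ∑)
  open FiniteSum K
  open NewtonSequence K
  open CoefficientList K
  open IntegerEmbedding K using (fromℕ-+; module ℤ-Solver)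
  open ℤ-Solver using (solve; _:=_; _:+_; _:*_; _:-_)
  open import Data.Nat.Base as ℕ using (ℕ; zero; suc; _≤_; _<_; _∸_; s≤s)
  import Data.Nat.Properties as ℕ
  open import Data.List.Base using (List; []; _∷_; length; drop)
  open import Relation.Nullary using (¬_; Dec; yes; no)
  open import Relation.Binary.PropositionalEquality as ≡ using (_≡_)
  open import Relation.Binary.Reasoning.Setoid setoid

  pow-+ : ∀ x m n → pow x (m ℕ.+ n) ≈ pow x m * pow x n
  pow-+ x zero    n = sym (*-identityˡ _)
  pow-+ x (suc m) n = trans (*-congˡ (pow-+ x m n)) (sym (*-assoc _ _ _))

  -- [q n, …, q 1, q 0], i.e. the polynomial ∑_{j ≤ n} q_j x^(n - j)
  reversal : (ℕ → Carrier) → ℕ → List Carrier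
  reversal q zero    = q 0 ∷ []
  reversal q (suc n) = q (suc n) ∷ reversal q n

  length-reversal : ∀ q n → length (reversal q n) ≡ suc n
  length-reversal q zero    = ≡.refl
  length-reversal q (suc n) = ≡.cong suc (length-reversal q n)

  drop-reversal : ∀ q {n} j → j ≤ n → drop j (reversal q n) ≡ reversal q (n ∸ j)
  drop-reversal q zero    _         = ≡.refl
  drop-reversal q (suc j) (s≤s j≤n) = drop-reversal q j j≤n

  coeff-reversal : ∀ q {n} j → j ≤ n → coeff (reversal q n) j ≡ q (n ∸ j)
  coeff-reversal q {zero}  zero    _         = ≡.refl
  coeff-reversal q {suc n} zero    _         = ≡.refl
  coeff-reversal q {suc n} (suc j) (s≤s j≤n) = coeff-reversal q j j≤n

  evalPoly-reversal : ∀ q n x → evalPoly (reversal q n) x ≈ ∑ (suc n) (λ j → q j * pow x (n ∸ j))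
  evalPoly-reversal q zero    x = trans (+-congˡ (zeroʳ x)) (trans (+-identityʳ _) (trans (sym (*-identityʳ _)) (sym (+-identityˡ _))))
  evalPoly-reversal q (suc n) x = begin
    q (suc n) + x * evalPoly (reversal q n) x                 ≈⟨ +-congˡ (*-congˡ (evalPoly-reversal q n x)) ⟩
    q (suc n) + x * ∑ (suc n) (λ j → q j * pow x (n ∸ j))     ≈⟨ +-congˡ (*-distribˡ-∑ (suc n) x _) ⟩
    q (suc n) + ∑ (suc n) (λ j → x * (q j * pow x (n ∸ j)))   ≈⟨ +-congˡ (∑-cong (suc n) shift) ⟩
    q (suc n) + ∑ (suc n) (λ j → q j * pow x (suc n ∸ j))     ≈⟨ +-comm _ _ ⟩
    ∑ (suc n) (λ j → q j * pow x (suc n ∸ j)) + q (suc n)     ≈⟨ +-congˡ top ⟩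
    ∑ (suc (suc n)) (λ j → q j * pow x (suc n ∸ j))           ∎
    where
    shift : ∀ j → j < suc n → x * (q j * pow x (n ∸ j)) ≈ q j * pow x (suc n ∸ j)
    shift j (s≤s j≤n) = trans (trans (sym (*-assoc _ _ _)) (trans (*-congʳ (*-comm x (q j))) (*-assoc _ _ _)))
                              (≡.subst (λ e → q j * pow x (suc (n ∸ j)) ≈ q j * pow x e) (≡.sym (ℕ.+-∸-assoc 1 j≤n)) refl)
    top : q (suc n) ≈ q (suc n) * pow x (suc n ∸ suc n)
    top = ≡.subst (λ e → q (suc n) ≈ q (suc n) * pow x e) (≡.sym (ℕ.n∸n≡0 n)) (sym (*-identityʳ _))

  powerSum : ℕ → (ℕ → Carrier) → ℕ → Carrier
  powerSum d β m = ∑ d (λ i → pow (β i) m)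

  powerSum-zero : ∀ d β → powerSum d β 0 ≈ fromℕ d
  powerSum-zero d β = ∑-const-1 d

  module _ (cancel : ∀ {a b} → ¬ a ≈ 0# → a * b ≈ 0# → b ≈ 0#)
           (d : ℕ) (q β : ℕ → Carrier)
           (distinct : ∀ i j → i < d → j < d → β i ≈ β j → i ≡ j)
           (roots : ∀ i → i < d → evalPoly (reversal q d) (β i) ≈ 0#)
           (q-beyond : ∀ j → d < j → q j ≈ 0#) where

    ∑-powerSum : ∀ t → ∑ (suc t) (λ j → q j * powerSum d β (t ∸ j)) ≈ ∑ d (λ i → ∑ (suc t) (λ j → q j * pow (β i) (t ∸ j)))
    ∑-powerSum t = trans (∑-cong (suc t) (λ j _ → *-distribˡ-∑ d (q j) _)) (sym (∑-comm d (suc t) _))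

    convolution-below : ∀ t → t < d → ∑ (suc t) (λ j → q j * powerSum d β (t ∸ j)) ≈ fromℕ (d ∸ t) * q t
    convolution-below t t<d = begin
      ∑ (suc t) (λ j → q j * powerSum d β (t ∸ j))             ≈⟨ ∑-powerSum t ⟩
      ∑ d (λ i → ∑ (suc t) (λ j → q j * pow (β i) (t ∸ j))) ≈⟨ ∑-cong d (λ i _ → sym (evalPoly-reversal q t (β i))) ⟩
      ∑ d (λ i → evalPoly (reversal q t) (β i))            ≡⟨ ≡.cong (λ L → ∑ d (λ i → evalPoly L (β i))) (≡.sym tail≡) ⟩
      ∑ d (λ i → evalPoly (drop (suc k) C) (β i))           ≈⟨ ∑-divideRoot≈derivative cancel d β C (ℕ.≤-reflexive (length-reversal q d)) distinct roots k ⟩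
      fromℕ (suc k) * coeff C (suc k)                       ≡⟨ ≡.cong₂ (λ a b → fromℕ a * b) 1+k≡ coeff≡ ⟩
      fromℕ (d ∸ t) * q t                                   ∎
      where
      C = reversal q d
      k = d ∸ suc t
      1+k≡ : suc k ≡ d ∸ t
      1+k≡ = ≡.sym (ℕ.+-∸-assoc 1 t<d)
      d-[d-t]≡t : d ∸ (d ∸ t) ≡ t
      d-[d-t]≡t = ℕ.m∸[m∸n]≡n (ℕ.<⇒≤ t<d)
      tail≡ : drop (suc k) C ≡ reversal q t
      tail≡ = ≡.trans (≡.cong (λ j → drop j C) 1+k≡)
                      (≡.trans (drop-reversal q (d ∸ t) (ℕ.m∸n≤m d t)) (≡.cong (reversal q) d-[d-t]≡t))
      coeff≡ : coeff C (suc k) ≡ q t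
      coeff≡ = ≡.trans (≡.cong (coeff C) 1+k≡) (≡.trans (coeff-reversal q (d ∸ t) (ℕ.m∸n≤m d t)) (≡.cong q d-[d-t]≡t))

    convolution-beyond : ∀ t → d ≤ t → ∑ (suc t) (λ j → q j * powerSum d β (t ∸ j)) ≈ fromℕ (d ∸ t) * q t
    convolution-beyond t d≤t = begin
      ∑ (suc t) (λ j → q j * powerSum d β (t ∸ j))             ≈⟨ ∑-truncate (suc d) (suc t) _ (s≤s d≤t)
                                                                  (λ j d<j _ → trans (*-congʳ (q-beyond j d<j)) (zeroˡ _)) ⟩
      ∑ (suc d) (λ j → q j * powerSum d β (t ∸ j))             ≈⟨ ∑-powerSum′ ⟩
      ∑ d (λ i → pow (β i) (t ∸ d) * evalPoly (reversal q d) (β i)) ≈⟨ ∑-zeros d (λ i i<d → trans (*-congˡ (roots i i<d)) (zeroʳ _)) ⟩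
      0#                                                    ≈⟨ sym (zeroˡ (q t)) ⟩
      0# * q t                                              ≡⟨ ≡.cong (λ n → fromℕ n * q t) (≡.sym (ℕ.m≤n⇒m∸n≡0 d≤t)) ⟩
      fromℕ (d ∸ t) * q t                                   ∎
      where
      exponent : ∀ j → j ≤ d → t ∸ j ≡ (t ∸ d) ℕ.+ (d ∸ j)
      exponent j j≤d = ≡.trans (≡.cong (_∸ j) (≡.sym (ℕ.m∸n+n≡m d≤t))) (ℕ.+-∸-assoc (t ∸ d) j≤d)
      termwise : ∀ i j → j ≤ d → q j * pow (β i) (t ∸ j) ≈ pow (β i) (t ∸ d) * (q j * pow (β i) (d ∸ j))
      termwise i j j≤d = begin
        q j * pow (β i) (t ∸ j)                          ≡⟨ ≡.cong (λ e → q j * pow (β i) e) (exponent j j≤d) ⟩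
        q j * pow (β i) ((t ∸ d) ℕ.+ (d ∸ j))            ≈⟨ *-congˡ (pow-+ (β i) (t ∸ d) (d ∸ j)) ⟩
        q j * (pow (β i) (t ∸ d) * pow (β i) (d ∸ j))    ≈⟨ sym (*-assoc _ _ _) ⟩
        q j * pow (β i) (t ∸ d) * pow (β i) (d ∸ j)      ≈⟨ *-congʳ (*-comm _ _) ⟩
        pow (β i) (t ∸ d) * q j * pow (β i) (d ∸ j)      ≈⟨ *-assoc _ _ _ ⟩
        pow (β i) (t ∸ d) * (q j * pow (β i) (d ∸ j))    ∎
      ∑-powerSum′ : ∑ (suc d) (λ j → q j * powerSum d β (t ∸ j)) ≈ ∑ d (λ i → pow (β i) (t ∸ d) * evalPoly (reversal q d) (β i))
      ∑-powerSum′ = begin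
        ∑ (suc d) (λ j → q j * powerSum d β (t ∸ j))                       ≈⟨ trans (∑-cong (suc d) (λ j _ → *-distribˡ-∑ d (q j) _))
                                                                                  (sym (∑-comm d (suc d) _)) ⟩
        ∑ d (λ i → ∑ (suc d) (λ j → q j * pow (β i) (t ∸ j)))          ≈⟨ ∑-cong d (λ i _ → ∑-cong (suc d) (λ j j<1+d → termwise i j (ℕ.≤-pred j<1+d))) ⟩
        ∑ d (λ i → ∑ (suc d) (λ j → pow (β i) (t ∸ d) * (q j * pow (β i) (d ∸ j))))
                                                                       ≈⟨ ∑-cong d (λ i _ → sym (*-distribˡ-∑ (suc d) _ _)) ⟩
        ∑ d (λ i → pow (β i) (t ∸ d) * ∑ (suc d) (λ j → q j * pow (β i) (d ∸ j)))
                                                                       ≈⟨ ∑-cong d (λ i _ → *-congˡ (sym (evalPoly-reversal q d (β i)))) ⟩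
        ∑ d (λ i → pow (β i) (t ∸ d) * evalPoly (reversal q d) (β i))  ∎

    convolution : ∀ t → ∑ (suc t) (λ j → q j * powerSum d β (t ∸ j)) ≈ fromℕ (d ∸ t) * q t
    convolution t with t ℕ.<? d
    ... | yes t<d = convolution-below t t<d
    ... | no  t≮d = convolution-beyond t (ℕ.≮⇒≥ t≮d)

    powerSum-powerSums : PowerSums q (powerSum d β)
    powerSum-powerSums n = begin
      X + N * qₙ                       ≈⟨ solve 4 (λ X N q S → X :+ N :* q := (X :+ q :* S) :+ N :* q :- q :* S) refl X N qₙ S₀ ⟩
      (X + qₙ * S₀) + N * qₙ - qₙ * S₀  ≈⟨ +-congʳ (+-congʳ (convolution n)) ⟩
      A * qₙ + N * qₙ - qₙ * S₀         ≈⟨ solve 4 (λ A N q S → A :* q :+ N :* q :- q :* S := (A :+ N :- S) :* q) refl A N qₙ S₀ ⟩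
      (A + N - S₀) * qₙ                ≈⟨ vanishes (n ℕ.≤? d) ⟩
      0#                              ∎
      where
      X = newtonSum q (powerSum d β) n
      N = fromℕ n
      A = fromℕ (d ∸ n)
      qₙ = q n
      S₀ = powerSum d β (n ∸ n)
      S₀≈d : S₀ ≈ fromℕ d
      S₀≈d = ≡.subst (λ m → powerSum d β m ≈ fromℕ d) (≡.sym (ℕ.n∸n≡0 n)) (powerSum-zero d β)
      vanishes : Dec (n ≤ d) → (A + N - S₀) * qₙ ≈ 0#
      vanishes (yes n≤d) = begin
        (A + N - S₀) * qₙ           ≈⟨ *-congʳ (+-cong (sym (fromℕ-+ (d ∸ n) n)) (-‿cong S₀≈d)) ⟩
        (fromℕ (d ∸ n ℕ.+ n) - fromℕ d) * qₙ ≡⟨ ≡.cong (λ m → (fromℕ m - fromℕ d) * qₙ) (ℕ.m∸n+n≡m n≤d) ⟩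
        (fromℕ d - fromℕ d) * qₙ    ≈⟨ *-congʳ (-‿inverseʳ _) ⟩
        0# * qₙ                     ≈⟨ zeroˡ qₙ ⟩
        0#                          ∎
      vanishes (no  n≰d) = trans (*-congˡ (q-beyond n (ℕ.≰⇒> n≰d))) (zeroʳ _)

module CharacteristicPolynomial where

  open import Data.Nat.Base as ℕ using (ℕ; zero; suc; _≤_; _<_; _∸_; z≤n; s≤s)
  import Data.Nat.Properties as ℕ
  open import Data.Integer.Base using (ℤ; +_; -_)
  open import Relation.Nullary using (yes; no)
  open import Relation.Binary.PropositionalEquality
  open import Data.Empty using (⊥-elim)

  -- coefficients of x^d C(1/x) = 1 - r₁ x - ⋯ - r_d x^d
  reversedCharCoeff : ℕ → (ℕ → ℤ) → ℕ → ℤ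
  reversedCharCoeff d r zero    = + 1
  reversedCharCoeff d r (suc i) with suc i ℕ.≤? d
  ... | yes _ = - r (suc i)
  ... | no  _ = + 0

  reversedCharCoeff-beyond : ∀ d r j → d < j → reversedCharCoeff d r j ≡ + 0
  reversedCharCoeff-beyond d r (suc i) d<j with suc i ℕ.≤? d
  ... | yes j≤d = ⊥-elim (ℕ.<⇒≱ d<j j≤d)
  ... | no  _   = refl

  -- the power sums of the roots of C, as an integer sequence
  charPowerSums : ℕ → (ℕ → ℤ) → ℕ → ℤ
  charPowerSums d r = IntegerRing.newtonSeq (reversedCharCoeff d r) (+ d)

  charPowerSums-powerSums : ∀ d r → IntegerRing.PowerSums (reversedCharCoeff d r) (charPowerSums d r)
  charPowerSums-powerSums d r = IntegerRing.newtonSeq-powerSums (reversedCharCoeff d r) (+ d) refl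

  charCoeff-reverse : ∀ d r j → j ≤ d → charCoeff d r (d ∸ j) ≡ reversedCharCoeff d r j
  charCoeff-reverse d r zero    _ with d ℕ.≟ d
  ... | yes _  = refl
  ... | no d≢d = ⊥-elim (d≢d refl)
  charCoeff-reverse d r (suc i) j≤d with d ∸ suc i ℕ.≟ d | d ∸ suc i ℕ.<? d | suc i ℕ.≤? d
  ... | yes d-j≡d | _          | _       = ⊥-elim (ℕ.<-irrefl d-j≡d d-j<d)
    where d-j<d = ℕ.∸-monoʳ-< {d} {suc i} {0} (s≤s z≤n) j≤d
  ... | no  _     | no  d-j≮d  | _       = ⊥-elim (d-j≮d (ℕ.∸-monoʳ-< {d} {suc i} {0} (s≤s z≤n) j≤d))
  ... | no  _     | yes _      | yes _   = cong (λ k → - r k) (ℕ.m∸[m∸n]≡n j≤d)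
  ... | no  _     | yes _      | no  j≰d = ⊥-elim (j≰d j≤d)

module PowerSumsOfRoots {c ℓ : Level} (K : CommutativeRing c ℓ) where

  open CommutativeRing K
  open OverRing K renaming (ΣK to ∑)
  open FiniteSum K
  open NewtonSequence K
  open IntegerEmbedding K
  open CoefficientList K using (evalPoly)
  open NewtonIdentities K
  open CharacteristicPolynomial
  open import Data.Nat.Base as ℕ using (ℕ; suc; _<_; _∸_)
  import Data.Nat.Properties as ℕ
  open import Data.Fin.Base using (Fin; fromℕ<; toℕ)
  import Data.Fin.Properties as Fin
  open import Data.Integer.Base as ℤ using (ℤ; +_)
  open import Data.Product.Base using (_,_; proj₁; proj₂)
  open import Relation.Nullary using (¬_; yes; no)
  open import Relation.Binary.PropositionalEquality as ≡ using (_≡_)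
  open import Relation.Binary.Reasoning.Setoid setoid
  open import Data.Empty using (⊥-elim)
  open ℤ-Solver using (solve; _:=_; _:*_)

  field-cancel : IsChar0Field → ∀ {a b} → ¬ a ≈ 0# → a * b ≈ 0# → b ≈ 0#
  field-cancel (_ , inverse , _) {a} {b} a≉0 ab≈0 with inverse a a≉0
  ... | a⁻¹ , aa⁻¹≈1 = begin
    b               ≈⟨ sym (*-identityˡ b) ⟩
    1# * b          ≈⟨ *-congʳ (sym aa⁻¹≈1) ⟩
    (a * a⁻¹) * b   ≈⟨ solve 3 (λ a a⁻¹ b → (a :* a⁻¹) :* b := a⁻¹ :* (a :* b)) refl a a⁻¹ b ⟩
    a⁻¹ * (a * b)   ≈⟨ *-congˡ ab≈0 ⟩
    a⁻¹ * 0#        ≈⟨ zeroʳ a⁻¹ ⟩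
    0#              ∎

  ι-powerSums : ∀ {F X} → IntegerRing.PowerSums F X → PowerSums (λ i → ι (F i)) (λ m → ι (X m))
  ι-powerSums {F} {X} ps n = begin
    ∑ n (λ i → ι (F i) * ι (X (n ∸ i))) + fromℕ n * ι (F n)
      ≈⟨ +-cong (trans (∑-cong n (λ i _ → sym (ι-* (F i) (X (n ∸ i))))) (sym (ι-∑ n _)))
                (trans (*-congʳ (reflexive (≡.cong ι (≡.sym (IntegerRing.fromℕ≡+ n))))) (sym (ι-* (IntegerRing.fromℕ n) (F n)))) ⟩
    ι (IntegerRing.newtonSum F X n) + ι (IntegerRing.fromℕ n ℤ.* F n)
      ≈⟨ sym (ι-+ (IntegerRing.newtonSum F X n) (IntegerRing.fromℕ n ℤ.* F n)) ⟩
    ι (IntegerRing.newtonDefect F X n)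
      ≡⟨ ≡.cong ι (ps n) ⟩
    0# ∎

  module _ {d : ℕ} (α : Fin d → Carrier) where

    extension : ℕ → Carrier
    extension i with i ℕ.<? d
    ... | yes i<d = α (fromℕ< i<d)
    ... | no  _   = 0#

    extension-distinct : (∀ i j → α i ≈ α j → i ≡ j) → ∀ i j → i < d → j < d → extension i ≈ extension j → i ≡ j
    extension-distinct α-injective i j i<d j<d with i ℕ.<? d | j ℕ.<? d
    ... | yes i<d′ | yes j<d′ = λ αᵢ≈αⱼ → ≡.trans (≡.sym (Fin.toℕ-fromℕ< i<d′))
                                           (≡.trans (≡.cong toℕ (α-injective _ _ αᵢ≈αⱼ)) (Fin.toℕ-fromℕ< j<d′))
    ... | no  i≮d  | _        = ⊥-elim (i≮d i<d)
    ... | _        | no  j≮d  = ⊥-elim (j≮d j<d)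

    extension-root : ∀ {r} → (∀ i → eval d (charCoeff d r) (α i) ≈ 0#) → ∀ i → i < d → eval d (charCoeff d r) (extension i) ≈ 0#
    extension-root roots i i<d with i ℕ.<? d
    ... | yes i<d′ = roots (fromℕ< i<d′)
    ... | no  i≮d  = ⊥-elim (i≮d i<d)

  module _ (isField : IsChar0Field) (d : ℕ) (r : ℕ → ℤ) (α : Fin d → Carrier) (roots : AreTheRoots d r α) where

    reversal-roots : ∀ i → i < d → evalPoly (reversal (λ j → ι (reversedCharCoeff d r j)) d) (extension α i) ≈ 0#
    reversal-roots i i<d = begin
      evalPoly (reversal (λ j → ι (reversedCharCoeff d r j)) d) x       ≈⟨ evalPoly-reversal _ d x ⟩
      ∑ (suc d) (λ j → ι (reversedCharCoeff d r j) * pow x (d ∸ j))    ≈⟨ ∑-cong (suc d) (λ j j<1+d → *-congʳ (reflexive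
                                                                           (≡.cong ι (≡.sym (charCoeff-reverse d r j (ℕ.≤-pred j<1+d)))))) ⟩
      ∑ (suc d) (λ j → ι (charCoeff d r (d ∸ j)) * pow x (d ∸ j))      ≈⟨ sym (∑-reverse d (λ k → ι (charCoeff d r k) * pow x k)) ⟩
      eval d (charCoeff d r) x                                         ≈⟨ extension-root α (proj₂ roots) i i<d ⟩
      0#                                                               ∎
      where
      x = extension α i

    private
      T = charPowerSums d r

    ι∘T≈powerSum : ∀ n → ι (T n) ≈ powerSum d (extension α) n
    ι∘T≈powerSum = powerSums-unique ι-1
      (ι-powerSums {X = T} (charPowerSums-powerSums d r))
      (powerSum-powerSums (field-cancel isField) d _ (extension α) (extension-distinct α (proj₁ roots)) reversal-roots
        (λ j d<j → reflexive (≡.cong ι (reversedCharCoeff-beyond d r j d<j))))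
      (trans (reflexive (≡.cong ι (IntegerRing.newtonSeq-zero (reversedCharCoeff d r) (+ d))))
             (sym (powerSum-zero d (extension α))))

    -- PowerSumForm extends α to ℕ in a where-block of its own; we read that summand off the proofs.
    private
      summand : ∀ m {x y} {f : ℕ → Carrier} → x ≈ y * ∑ m f → ℕ → Carrier
      summand _ {f = f} _ = f

    powerSumForm-extension : ∀ {l U} → PowerSumForm d α l U → ∀ n → ι (U n) ≈ l * powerSum d (extension α) n
    powerSumForm-extension {l} {U} psf n = trans (psf n) (*-congˡ (∑-cong d {summand d (psf n)} {λ i → pow (extension α i) n} same))
      where
      same : ∀ i → i < d → summand d (psf n) i ≈ pow (extension α i) n
      same i i<d with i ℕ.<? d
      ... | yes _   = refl
      ... | no  i≮d = ⊥-elim (i≮d i<d)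

    d*U≡U₀*T : ∀ {l U} → PowerSumForm d α l U → ∀ n → + d ℤ.* U n ≡ U 0 ℤ.* T n
    d*U≡U₀*T {l} {U} psf n = ι-injective (proj₂ (proj₂ isField)) _ _ (begin
      ι (+ d ℤ.* U n)            ≈⟨ ι-* (+ d) (U n) ⟩
      fromℕ d * ι (U n)          ≈⟨ *-congˡ (powerSumForm-extension {U = U} psf n) ⟩
      fromℕ d * (l * S n)        ≈⟨ solve 3 (λ D l s → D :* (l :* s) := (l :* D) :* s) refl (fromℕ d) l (S n) ⟩
      (l * fromℕ d) * S n        ≈⟨ *-cong (*-congˡ (sym (powerSum-zero d (extension α)))) (sym (ι∘T≈powerSum n)) ⟩
      (l * S 0) * ι (T n)        ≈⟨ *-congʳ (sym (powerSumForm-extension {U = U} psf 0)) ⟩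
      ι (U 0) * ι (T n)          ≈⟨ sym (ι-* (U 0) (T n)) ⟩
      ι (U 0 ℤ.* T n)            ∎)
      where
      S = powerSum d (extension α)

open import Data.Nat using (ℕ; _≤_; _∸_; suc)
open import Data.Integer using (ℤ; _*_)
open import Data.Fin using (Fin)
open import Relation.Binary.PropositionalEquality using (_≡_; refl; sym)
open import Data.Product.Base using (_,_)
open CharacteristicPolynomial using (charPowerSums; charPowerSums-powerSums; reversedCharCoeff)
open DoldSums using (dold-cong; dold-*ˡ; powerSums-dold)
open PowersDold using (powers-dold)

charPowerSums-dold : ∀ d r → DoldCondition (charPowerSums d r)
charPowerSums-dold d r =
  powerSums-dold {reversedCharCoeff d r} {charPowerSums d r} refl (charPowerSums-powerSums d r) powers-dold

corollary3 : {c ℓ : Level} (K : CommutativeRing c ℓ) → OverRing.IsChar0Field K →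
    (d : ℕ) → 1 ≤ d → (r : ℕ → ℤ) → (U : ℕ → ℤ) →
    (∀ n → d ≤ n → U n ≡ Σℤ d (λ i → r (suc i) * U (n ∸ suc i))) →
    IrreducibleOverℚ d (charCoeff d r) →
    (α : Fin d → CommutativeRing.Carrier K) → OverRing.AreTheRoots K d r α →
    (l : CommutativeRing.Carrier K) → OverRing.PowerSumForm K d α l U →
    AlmostDold U
corollary3 K isField d 1≤d r U _ _ α roots l psf =
  d , 1≤d , dold-cong (λ n → sym (d*U≡U₀*T isField d r α roots {U = U} psf n))
                      (dold-*ˡ (U 0) {charPowerSums d r} (charPowerSums-dold d r))
  where
  open PowerSumsOfRoots K using (d*U≡U₀*T)
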